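{- Let $X,Y$ be disjoint finite sets. Then in $\mathcal{P}(X\sqcup Y)$, $$\sum_{\phi} q_\phi^{\ast}\,\chi(X\sqcup_\phi Y) = \chi(X)\,\chi(Y),$$ where the sum is over all partial pairings $\phi$ between $X$ and $Y$, including the empty partial pairing.
   Context: For a finite set $S$, $\mathcal{P}(S)$ is the free abelian group on the set of all partitions of $S$. For a partition $\pi$ of $S$ with parts $P_1,\dots,P_k$, let $\epsilon(\pi) = \prod_{i=1}^k (-1)^{\#P_i - 1}$ (the sign of any permutation whose orbits are the parts of $\pi$) and $n(\pi) = \prod_{i=1}^k (\#P_i - 1)!$ (the number of such permutations). Set $\chi(S) = \sum_\pi \epsilon(\pi)n(\pi)\,\pi \in \mathcal{P}(S)$, summing over all partitions of $S$. If $\pi_1,\pi_2$ are partitions of $X$ and $Y$, $\pi_1\pi_2$ denotes the partition of $X\sqcup Y$ whose parts are the parts of $\pi_1$ and of $\pi_2$; this extends bilinearly to a product $\mathcal{P}(X)\times\mathcal{P}(Y)\to\mathcal{P}(X\sqcup Y)$. For a surjective map $g : S \to T$ and a partition $\pi$ of $T$, $g^{\ast}\pi$ is the partition of $S$ whose parts are the preimages of the parts of $\pi$; this extends linearly to $g^\ast : \mathcal{P}(T) \to \mathcal{P}(S)$. A partial pairing $\phi$ between $X$ and $Y$ is a bijection $\phi : X_\phi \to Y_\phi$ between subsets $X_\phi\subset X$, $Y_\phi \subset Y$; $X\sqcup_\phi Y$ is the quotient of $X\sqcup Y$ by the equivalence relation identifying $x$ with $\phi(x)$ for $x\in X_\phi$,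 and $q_\phi : X\sqcup Y \to X\sqcup_\phi Y$ is the quotient map. -}

module Defs where

open import Data.Bool.Base using (Bool; true; false; _∧_; _∨_; not; if_then_else_)
open import Data.Nat.Base using (ℕ; zero; suc; _≡ᵇ_; _<ᵇ_; _!; _∸_) renaming (_+_ to _+ℕ_; _*_ to _*ℕ_)
open import Data.Integer.Base using (ℤ; +_; -_; _*_; _+_; _^_; -1ℤ; 1ℤ)
open import Data.Fin.Base using (Fin; zero; suc; toℕ; splitAt; join; _↑ˡ_)
open import Data.Fin.Properties using (_≟_)
open import Data.Maybe.Base using (Maybe; nothing; just; is-just)
import Data.Maybe.Base as Maybe
open import Data.Sum.Base using (inj₁; inj₂; [_,_]′)
open import Data.Product.Base using (_×_; _,_)
open import Data.List.Base using (List; []; _∷_; map; concatMap; filterᵇ; foldr; upTo; allFin; _++_)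
open import Data.Bool.ListAction using (all; any)
import Data.Vec.Functional as VF
open import Function.Base using (_∘_)
open import Relation.Nullary.Decidable.Core using (does)

-- Every finite set is modelled as a subset S of some Fin N, given by its
-- membership test  S : Fin N → Bool.  The disjoint union X ⊔ Y of
-- X = Fin m and Y = Fin n is Fin (m + n) (via splitAt / join).
--
-- A partition of S is represented by a block labelling  f : Fin N → ℕ :
-- two members i j of S lie in the same part iff  f i ≡ f j  (labels of
-- non-members are irrelevant).  Two labellings of the whole of Fin N
-- represent the same partition iff they have the same kernel.

Subset : ℕ → Set
Subset N = Fin N → Bool

full : ∀ {N} → Subset N
full _ = true

Labelling : ℕ → Set
Labelling N = Fin N → ℕ

_⇔ᵇ_ : Bool → Bool → Bool
a ⇔ᵇ b = (a ∧ b) ∨ (not a ∧ not b)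

samePartition : ∀ {N} → Labelling N → Labelling N → Bool
samePartition {N} f g =
  all (λ i → all (λ j → (f i ≡ᵇ f j) ⇔ᵇ (g i ≡ᵇ g j)) (allFin N)) (allFin N)

-- Enumeration of all partitions of a subset S, each exactly once:
-- restricted growth strings along the members of S (in increasing order);
-- k is the number of blocks opened so far; non-members get label 0.

rgs : ∀ N → Subset N → ℕ → List (Labelling N)
rgs zero    S k = VF.[] ∷ []
rgs (suc N) S k with S zero
... | false = map (0 VF.∷_) (rgs N (S ∘ suc) k)
... | true  = concatMap
                (λ a → map (a VF.∷_)
                          (rgs N (S ∘ suc) (if a ≡ᵇ k then suc k else k)))
                (upTo (suc k))

partitions : ∀ {N} → Subset N → List (Labelling N)
partitions {N} S = rgs N S 0

-- Elements of 𝒫(S): formal ℤ-linear combinations of partitions, compared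
-- via their coefficients (free abelian group on the set of partitions).

𝒫 : ℕ → Set
𝒫 N = List (ℤ × Labelling N)

sumℤ : List ℤ → ℤ
sumℤ = foldr _+_ (+ 0)

prodℤ : List ℤ → ℤ
prodℤ = foldr _*_ (+ 1)

coeff : ∀ {N} → 𝒫 N → Labelling N → ℤ
coeff s π = sumℤ (map (λ { (c , ρ) → if samePartition ρ π then c else + 0 }) s)

_≋_ : ∀ {N} → 𝒫 N → 𝒫 N → Set
s ≋ t = ∀ π → coeff s π Relation.Binary.PropositionalEquality.≡ coeff t π
  where import Relation.Binary.PropositionalEquality

countᵇ : ∀ {N} → (Fin N → Bool) → ℕ
countᵇ {N} p = foldr (λ i acc → if p i then suc acc else acc) 0 (allFin N)

partSize : ∀ {N} → Subset N → Labelling N → Fin N → ℕ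
partSize S f i = countᵇ (λ j → S j ∧ (f j ≡ᵇ f i))

isLeader : ∀ {N} → Subset N → Labelling N → Fin N → Bool
isLeader {N} S f i =
  S i ∧ not (any (λ j → S j ∧ (f j ≡ᵇ f i) ∧ (toℕ j <ᵇ toℕ i)) (allFin N))

εn : ∀ {N} → Subset N → Labelling N → ℤ
εn {N} S f =
  prodℤ (map (λ i → (-1ℤ ^ (partSize S f i ∸ 1)) * + ((partSize S f i ∸ 1) !))
             (filterᵇ (isLeader S f) (allFin N)))

χ : ∀ {N} → Subset N → 𝒫 N
χ S = map (λ f → (εn S f , f)) (partitions S)

-- Product 𝒫(X) × 𝒫(Y) → 𝒫(X ⊔ Y): parts of π₁ on X and of π₂ on Y
-- (labels 2a on X and 2b+1 on Y keep the parts apart).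

mulPart : ∀ {m n} → Labelling m → Labelling n → Labelling (m +ℕ n)
mulPart {m} ρ σ i = [ (λ x → 2 *ℕ ρ x) , (λ y → suc (2 *ℕ σ y)) ]′ (splitAt m i)

_⊛_ : ∀ {m n} → 𝒫 m → 𝒫 n → 𝒫 (m +ℕ n)
s ⊛ t = concatMap (λ { (c , ρ) → map (λ { (d , σ) → (c * d , mulPart ρ σ) }) t }) s

pullback : ∀ {N M} → (Fin N → Fin M) → 𝒫 M → 𝒫 N
pullback g = map (λ { (c , π) → (c , π ∘ g) })

-- Partial pairings between X = Fin m and Y = Fin n: a partial injective map
-- φ : Fin m → Maybe (Fin n) (X_φ = domain, Y_φ = image, φ : X_φ ≅ Y_φ).

allMaps : ∀ m n → List (Fin m → Maybe (Fin n))
allMaps zero    n = VF.[] ∷ []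
allMaps (suc m) n =
  concatMap (λ v → map (VF._∷ v) (nothing ∷ map just (allFin n))) (allMaps m n)

hits : ∀ {n} → Maybe (Fin n) → Fin n → Bool
hits nothing  y = false
hits (just z) y = does (z ≟ y)

isInjectivePartial : ∀ {m n} → (Fin m → Maybe (Fin n)) → Bool
isInjectivePartial {m} {n} φ =
  all (λ i → all (λ j → does (i ≟ j) ∨
      not (any (λ y → hits (φ i) y ∧ hits (φ j) y) (allFin n)))
    (allFin m)) (allFin m)

partialPairings : ∀ m n → List (Fin m → Maybe (Fin n))
partialPairings m n = filterᵇ isInjectivePartial (allMaps m n)

search : ∀ {m} → (Fin m → Bool) → Maybe (Fin m)
search {zero}  p = nothing
search {suc m} p = if p zero then just zero else Maybe.map suc (search (p ∘ suc))

preimage : ∀ {m n} → (Fin m → Maybe (Fin n)) → Fin n → Maybe (Fin m)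
preimage φ y = search (λ x → hits (φ x) y)

-- X ⊔_φ Y is modelled by its set of representatives inside X ⊔ Y = Fin (m+n):
-- all of X together with Y ∖ Y_φ.
glued : ∀ {m n} → (Fin m → Maybe (Fin n)) → Subset (m +ℕ n)
glued {m} φ i = [ (λ x → true) , (λ y → not (is-just (preimage φ y))) ]′ (splitAt m i)

q : ∀ {m n} → (Fin m → Maybe (Fin n)) → Fin (m +ℕ n) → Fin (m +ℕ n)
q {m} {n} φ i =
  [ (λ x → x ↑ˡ n) ,
    (λ y → Maybe.maybe (λ x → x ↑ˡ n) i (preimage φ y)) ]′ (splitAt m i)

gluedSum : ∀ m n → 𝒫 (m +ℕ n)
gluedSum m n = concatMap (λ φ → pullback (q φ) (χ (glued φ))) (partialPairings m n)

-- Compare the coefficients of a partition π of X ⊔ Y. Listing X ⊔ Y in order, ε(ρ) n(ρ) is a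
-- product over elements: an element with k later elements in its part contributes 1 if k = 0 and
-- -k otherwise. As the restricted growth strings enumerate every partition once, the coefficient
-- of π on the right is this product for π on X times that for π on Y when no part of π meets both
-- X and Y, and 0 otherwise; on the left it is the sum, over the pairings φ that only pair elements
-- of a common part of π, of the product for π on X ⊔_φ Y. Induct on X by removing its first
-- element x. If the part of x has k > 0 further elements in X and p elements of Y left unpaired by
-- the rest of φ, leaving x unpaired contributes -(k + p) and pairing it with one of these p
-- elements contributes 1, in total -k; if k = 0, no element of Y in the part of x is paired by
-- the rest of φ, and the total is 1 or 0 according as the part misses Y or not. In each case this
-- is the factor x contributes on the right.

{-# OPTIONS --safe #-}
module Submission where

open import Defs
open import Data.Bool.Base using (Bool; true; false; _∧_; not; if_then_else_)
open import Data.Bool.ListAction using (all; any)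
open import Data.Bool.Properties using (∧-zeroʳ; ∧-identityʳ)
open import Data.Fin.Base using (Fin; zero; suc; toℕ; fromℕ<; _↑ˡ_; _↑ʳ_; splitAt)
open import Data.Fin.Properties
  using (_≟_; splitAt-↑ˡ; splitAt-↑ʳ; splitAt⁻¹-↑ˡ; splitAt⁻¹-↑ʳ; toℕ-injective; any?; all?; toℕ<n;
         toℕ-fromℕ<)
  renaming (suc-injective to Fin-suc-injective)
open import Data.Integer.Base using (ℤ; +_; -_; _*_; _+_; 1ℤ; 0ℤ; -1ℤ; _^_)
open import Data.Integer.Properties
  using (suc-*; *-assoc; +-identityˡ; +-identityʳ; +-assoc; *-zeroʳ; *-identityˡ; *-distribˡ-+)
import Data.Integer.Properties as ℤ
open import Algebra.Properties.CommutativeSemigroup ℤ.*-commutativeSemigroup using (x∙yz≈y∙xz)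
open import Data.Integer.Solver using (module +-*-Solver)
open import Data.List.Base using (List; []; _∷_; map; foldr; _++_; concatMap; filterᵇ; tabulate; applyUpTo; upTo; allFin)
open import Data.List.Properties using (map-tabulate; tabulate-cong)
open import Data.Maybe.Base using (Maybe; nothing; just; is-just; maybe)
open import Data.Maybe.Properties using (just-injective)
open import Data.Nat.Base using (ℕ; zero; suc; _≡ᵇ_; _<_; _!; _∸_; s≤s; z≤n)
import Data.Nat.Base as ℕ
import Data.Nat.Properties as ℕₚ
open import Data.Product.Base using (_×_; _,_; proj₁; proj₂; ∃)
open import Data.Sum.Base using (_⊎_; inj₁; inj₂)
import Data.Vec.Functional as VF
open import Function.Base using (_∘_; id)
open import Function.Bundles using (_⇔_; mk⇔; Equivalence)
open import Relation.Binary.Definitions using (tri<; tri≈; tri>)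
open import Relation.Binary.PropositionalEquality
open import Relation.Nullary.Decidable.Core using (Dec; does; proof; yes; no; ¬?; _×-dec_)
open import Relation.Nullary.Decidable using (does-⇔; dec-true; dec-false)
open import Relation.Nullary.Negation.Core using (¬_; contradiction)
open import Relation.Nullary.Reflects using (Reflects; ofʸ; ofⁿ; _×-reflects_; _⊎-reflects_; ¬-reflects; det)

-- Data.Nat's _≟_ decides through _≡ᵇ_, so its proof component reflects m ≡ᵇ n.
≡ᵇ-reflects : ∀ m n → Reflects (m ≡ n) (m ≡ᵇ n)
≡ᵇ-reflects m n = proof (m ℕₚ.≟ n)

≡ᵇ-refl : ∀ n → (n ≡ᵇ n) ≡ true
≡ᵇ-refl n with n ≡ᵇ n | ≡ᵇ-reflects n n
... | true  | _ = refl
... | false | ofⁿ n≢n = contradiction refl n≢n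

∧-true⁻ : ∀ a {b} → a ∧ b ≡ true → a ≡ true × b ≡ true
∧-true⁻ true b≡true = refl , b≡true

≡ᵇ-true : ∀ {m n} → m ≡ n → (m ≡ᵇ n) ≡ true
≡ᵇ-true {m} refl = ≡ᵇ-refl m

≡ᵇ-false : ∀ {m n} → m ≢ n → (m ≡ᵇ n) ≡ false
≡ᵇ-false {m} {n} m≢n with m ≡ᵇ n | ≡ᵇ-reflects m n
... | true  | ofʸ m≡n = contradiction m≡n m≢n
... | false | _       = refl

≡ᵇ-sym : ∀ m n → (m ≡ᵇ n) ≡ (n ≡ᵇ m)
≡ᵇ-sym m n with m ≡ᵇ n | ≡ᵇ-reflects m n
... | true  | ofʸ refl = sym (≡ᵇ-refl m)
... | false | ofⁿ m≢n with n ≡ᵇ m | ≡ᵇ-reflects n m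
...   | true  | ofʸ refl = contradiction refl m≢n
...   | false | _ = refl

reflects-map : ∀ {A B : Set} {b} → (A → B) → (B → A) → Reflects A b → Reflects B b
reflects-map f g (ofʸ a)  = ofʸ (f a)
reflects-map f g (ofⁿ ¬a) = ofⁿ (¬a ∘ g)

≡true-reflects : ∀ b → Reflects (b ≡ true) b
≡true-reflects false = ofⁿ λ ()
≡true-reflects true  = ofʸ refl

reflects-true⁻ : ∀ {A : Set} {b} → Reflects A b → b ≡ true → A
reflects-true⁻ (ofʸ a) _ = a

reflects-true⁺ : ∀ {A : Set} {b} → Reflects A b → A → b ≡ true
reflects-true⁺ (ofʸ _)  _ = refl
reflects-true⁺ (ofⁿ ¬a) a = contradiction a ¬a

reflects-false⁺ : ∀ {A : Set} {b} → Reflects A b → ¬ A → b ≡ false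
reflects-false⁺ (ofʸ a) ¬a = contradiction a ¬a
reflects-false⁺ (ofⁿ _) _  = refl

all-tabulate-reflects : ∀ {A : Set} {N} {P : Fin N → Set} (p : A → Bool) (g : Fin N → A) →
  (∀ i → Reflects (P i) (p (g i))) → Reflects (∀ i → P i) (all p (tabulate g))
all-tabulate-reflects {N = zero}  p g r = ofʸ λ ()
all-tabulate-reflects {N = suc N} p g r =
  reflects-map (λ { (P0 , Ps) → λ { zero → P0 ; (suc i) → Ps i } }) (λ P → P zero , P ∘ suc)
    (r zero ×-reflects all-tabulate-reflects p (g ∘ suc) (r ∘ suc))

any-tabulate-reflects : ∀ {A : Set} {N} {P : Fin N → Set} (p : A → Bool) (g : Fin N → A) →
  (∀ i → Reflects (P i) (p (g i))) → Reflects (∃ P) (any p (tabulate g))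
any-tabulate-reflects {N = zero}  p g r = ofⁿ λ ()
any-tabulate-reflects {N = suc N} p g r =
  reflects-map (λ { (inj₁ P0) → zero , P0 ; (inj₂ (i , Pi)) → suc i , Pi })
               (λ { (zero , P0) → inj₁ P0 ; (suc i , Pi) → inj₂ (i , Pi) })
    (r zero ⊎-reflects any-tabulate-reflects p (g ∘ suc) (r ∘ suc))

⇔ᵇ-reflects : ∀ a b → Reflects (a ≡ b) (a ⇔ᵇ b)
⇔ᵇ-reflects false false = ofʸ refl
⇔ᵇ-reflects false true  = ofⁿ λ ()
⇔ᵇ-reflects true  false = ofⁿ λ ()
⇔ᵇ-reflects true  true  = ofʸ refl

∑ : ∀ {A : Set} → (A → ℤ) → List A → ℤ
∑ F xs = sumℤ (map F xs)

∑-++ : ∀ {A : Set} (F : A → ℤ) xs ys → ∑ F (xs ++ ys) ≡ ∑ F xs + ∑ F ys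
∑-++ F []       ys = sym (+-identityˡ _)
∑-++ F (x ∷ xs) ys = trans (cong (_+_ (F x)) (∑-++ F xs ys)) (sym (+-assoc (F x) _ _))

∑-concatMap : ∀ {A B : Set} (F : B → ℤ) (G : A → List B) xs →
  ∑ F (concatMap G xs) ≡ ∑ (λ x → ∑ F (G x)) xs
∑-concatMap F G []       = refl
∑-concatMap F G (x ∷ xs) = trans (∑-++ F (G x) _) (cong (_+_ (∑ F (G x))) (∑-concatMap F G xs))

∑-map : ∀ {A B : Set} (F : B → ℤ) (g : A → B) xs → ∑ F (map g xs) ≡ ∑ (F ∘ g) xs
∑-map F g []       = refl
∑-map F g (x ∷ xs) = cong (_+_ (F (g x))) (∑-map F g xs)

∑-cong : ∀ {A : Set} {F G : A → ℤ} → (∀ x → F x ≡ G x) → ∀ xs → ∑ F xs ≡ ∑ G xs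
∑-cong F≗G []       = refl
∑-cong F≗G (x ∷ xs) = cong₂ _+_ (F≗G x) (∑-cong F≗G xs)

∑-zero : ∀ {A : Set} {F : A → ℤ} → (∀ x → F x ≡ 0ℤ) → ∀ xs → ∑ F xs ≡ 0ℤ
∑-zero F≗0 []       = refl
∑-zero F≗0 (x ∷ xs) = cong₂ _+_ (F≗0 x) (∑-zero F≗0 xs)

∑-*ˡ : ∀ {A : Set} (c : ℤ) (F : A → ℤ) xs → ∑ (λ x → c * F x) xs ≡ c * ∑ F xs
∑-*ˡ c F []       = sym (*-zeroʳ c)
∑-*ˡ c F (x ∷ xs) = trans (cong (_+_ (c * F x)) (∑-*ˡ c F xs)) (sym (*-distribˡ-+ c (F x) _))

∑-filterᵇ : ∀ {A : Set} (F : A → ℤ) (P : A → Bool) xs →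
  ∑ F (filterᵇ P xs) ≡ ∑ (λ x → if P x then F x else 0ℤ) xs
∑-filterᵇ F P []       = refl
∑-filterᵇ F P (x ∷ xs) with P x
... | true  = cong (_+_ (F x)) (∑-filterᵇ F P xs)
... | false = trans (∑-filterᵇ F P xs) (sym (+-identityˡ _))

∑-applyUpTo-zero : ∀ {A : Set} (F : A → ℤ) (g : ℕ → A) n →
  (∀ b → b < n → F (g b) ≡ 0ℤ) → ∑ F (applyUpTo g n) ≡ 0ℤ
∑-applyUpTo-zero F g zero    F∘g≗0 = refl
∑-applyUpTo-zero F g (suc n) F∘g≗0 =
  cong₂ _+_ (F∘g≗0 0 (s≤s z≤n)) (∑-applyUpTo-zero F (g ∘ suc) n (λ b b<n → F∘g≗0 (suc b) (s≤s b<n)))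

∑-applyUpTo-single : ∀ {A : Set} (F : A → ℤ) (g : ℕ → A) n a → a < n →
  (∀ b → b < n → b ≢ a → F (g b) ≡ 0ℤ) → ∑ F (applyUpTo g n) ≡ F (g a)
∑-applyUpTo-single F g (suc n) zero a<n others =
  trans (cong (_+_ (F (g 0))) (∑-applyUpTo-zero F (g ∘ suc) n (λ b b<n → others (suc b) (s≤s b<n) λ ())))
        (+-identityʳ _)
∑-applyUpTo-single F g (suc n) (suc a) (s≤s a<n) others =
  trans (cong₂ _+_ (others 0 (s≤s z≤n) λ ())
                   (∑-applyUpTo-single F (g ∘ suc) n a a<n
                      (λ b b<n b≢a → others (suc b) (s≤s b<n) (b≢a ∘ ℕₚ.suc-injective))))
        (+-identityˡ _)

count : ∀ {N} → (Fin N → Bool) → ℕ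
count {zero}  p = 0
count {suc N} p = if p zero then suc (count (p ∘ suc)) else count (p ∘ suc)

countᵇ≡count : ∀ {N} (p : Fin N → Bool) → countᵇ p ≡ count p
countᵇ≡count p = go p id
  where
  go : ∀ {A : Set} {N} (p : A → Bool) (g : Fin N → A) →
    foldr (λ x acc → if p x then suc acc else acc) 0 (tabulate g) ≡ count (p ∘ g)
  go {N = zero}  p g = refl
  go {N = suc N} p g rewrite go p (g ∘ suc) = refl

count-cong : ∀ {N} {p p′ : Fin N → Bool} → (∀ i → p i ≡ p′ i) → count p ≡ count p′
count-cong {zero}  p≗p′ = refl
count-cong {suc N} p≗p′ rewrite p≗p′ zero | count-cong (p≗p′ ∘ suc) = refl

count≡0⇒ : ∀ {N} {p : Fin N → Bool} → count p ≡ 0 → ∀ i → p i ≡ false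
count≡0⇒ {suc N} {p} #p≡0 i with p zero in p0
count≡0⇒ {suc N} {p} ()   i       | true
count≡0⇒ {suc N} {p} #p≡0 zero    | false = p0
count≡0⇒ {suc N} {p} #p≡0 (suc i) | false = count≡0⇒ #p≡0 i

count≡suc⇒ : ∀ {N} {p : Fin N → Bool} {k} → count p ≡ suc k → ∃ λ i → p i ≡ true
count≡suc⇒ {suc N} {p} #p≡1+k with p zero in p0
... | true  = zero , p0
... | false with count≡suc⇒ #p≡1+k
...   | i , pi = suc i , pi

count-↑ : ∀ m n (p : Fin (m ℕ.+ n) → Bool) → count p ≡ count (p ∘ (_↑ˡ n)) ℕ.+ count (p ∘ (m ↑ʳ_))
count-↑ zero    n p = refl
count-↑ (suc m) n p with p zero
... | true  = cong suc (count-↑ m n (p ∘ suc))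
... | false = count-↑ m n (p ∘ suc)

count-≡ᵇ≡0⇒ : ∀ {N} (f : Fin N → ℕ) {a} → count (λ i → f i ≡ᵇ a) ≡ 0 → ∀ i → f i ≢ a
count-≡ᵇ≡0⇒ f #≡0 i fi≡a = contradiction (trans (sym (count≡0⇒ #≡0 i)) (≡ᵇ-true fi≡a)) λ ()

count-≡ᵇ≡suc⇒ : ∀ {N} (f : Fin N → ℕ) {a k} → count (λ i → f i ≡ᵇ a) ≡ suc k → ∃ λ i → f i ≡ a
count-≡ᵇ≡suc⇒ f {a} #≡1+k with count≡suc⇒ {p = λ i → f i ≡ᵇ a} #≡1+k
... | i , fi≡ᵇa = i , reflects-true⁻ (≡ᵇ-reflects (f i) a) fi≡ᵇa

∑-tabulate-indicator : ∀ {A : Set} {N} (p : A → Bool) (z : ℤ) (g : Fin N → A) →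
  ∑ (λ x → if p x then z else 0ℤ) (tabulate g) ≡ + count (p ∘ g) * z
∑-tabulate-indicator {N = zero}  p z g = refl
∑-tabulate-indicator {N = suc N} p z g with p (g zero)
... | true  = trans (cong (_+_ z) (∑-tabulate-indicator p z (g ∘ suc))) (sym (suc-* (+ count (p ∘ g ∘ suc)) z))
... | false = trans (+-identityˡ _) (∑-tabulate-indicator p z (g ∘ suc))

-- Partitions as kernels of labellings

SamePartition : ∀ {N} → Labelling N → Labelling N → Set
SamePartition f g = ∀ i j → (f i ≡ᵇ f j) ≡ (g i ≡ᵇ g j)

samePartition-reflects : ∀ {N} (f g : Labelling N) → Reflects (SamePartition f g) (samePartition f g)
samePartition-reflects f g =
  all-tabulate-reflects _ id λ i → all-tabulate-reflects _ id λ j → ⇔ᵇ-reflects _ _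

samePartition-true : ∀ {N} (ρ π : Labelling N) {c : ℤ} → SamePartition ρ π →
  (if samePartition ρ π then c else 0ℤ) ≡ c
samePartition-true ρ π sp rewrite reflects-true⁺ (samePartition-reflects ρ π) sp = refl

samePartition-false : ∀ {N} (ρ π : Labelling N) {c : ℤ} → ¬ SamePartition ρ π →
  (if samePartition ρ π then c else 0ℤ) ≡ 0ℤ
samePartition-false ρ π ¬sp rewrite reflects-false⁺ (samePartition-reflects ρ π) ¬sp = refl

SameOn : ∀ {N} → Subset N → Labelling N → Labelling N → Set
SameOn S f g = ∀ i j → S i ≡ true → S j ≡ true → (f i ≡ᵇ f j) ≡ (g i ≡ᵇ g j)

inPart : ∀ {N} → Subset N → Labelling N → ℕ → Fin N → Bool
inPart S f a j = S j ∧ (f j ≡ᵇ a)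

-- ε(π) n(π) as a product over elements

laterFactor : ℕ → ℤ
laterFactor zero    = 1ℤ
laterFactor (suc k) = - (+ suc k)

-- weight S f is ε n of the partition that f induces on S: every element contributes laterFactor of
-- the number of later elements of its part, so a part of size s contributes
-- laterFactor (s - 1) ⋯ laterFactor 0 = (-1)^(s-1) (s-1)!.
firstFactor : ∀ {N} → Subset (suc N) → Labelling (suc N) → ℤ
firstFactor S f = if S zero then laterFactor (count (inPart (S ∘ suc) (f ∘ suc) (f zero))) else 1ℤ

weight : ∀ {N} → Subset N → Labelling N → ℤ
weight {zero}  S f = 1ℤ
weight {suc N} S f = firstFactor S f * weight (S ∘ suc) (f ∘ suc)

weight-cong : ∀ {N} (S : Subset N) {f g : Labelling N} → SameOn S f g → weight S f ≡ weight S g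
weight-cong {zero}  S f~g = refl
weight-cong {suc N} S {f} {g} f~g = cong₂ _*_ head (weight-cong (S ∘ suc) λ i j → f~g (suc i) (suc j))
  where
  head : firstFactor S f ≡ firstFactor S g
  head with S zero in S0
  ... | false = refl
  ... | true  = cong laterFactor (count-cong later)
    where
    later : ∀ j → inPart (S ∘ suc) (f ∘ suc) (f zero) j ≡ inPart (S ∘ suc) (g ∘ suc) (g zero) j
    later j with S (suc j) in Sj
    ... | false = refl
    ... | true  = f~g (suc j) zero Sj S0

weight-cong-subset : ∀ {N} {S S′ : Subset N} (f : Labelling N) → (∀ i → S i ≡ S′ i) → weight S f ≡ weight S′ f
weight-cong-subset {zero}  f S≗S′ = refl
weight-cong-subset {suc N} {S} {S′} f S≗S′ rewrite S≗S′ zero =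
  cong₂ (λ k w → (if S′ zero then laterFactor k else 1ℤ) * w)
        (count-cong λ j → cong (_∧ (f (suc j) ≡ᵇ f zero)) (S≗S′ (suc j)))
        (weight-cong-subset (f ∘ suc) (S≗S′ ∘ suc))

Without : ∀ {N} → Subset N → Fin N → Subset N → Set
Without S y S′ = S′ y ≡ false × (∀ j → j ≢ y → S′ j ≡ S j)

Without-suc : ∀ {N} {S S′ : Subset (suc N)} {y} → Without S (suc y) S′ → Without (S ∘ suc) y (S′ ∘ suc)
Without-suc (S′y , S′≗S) = S′y , λ j j≢y → S′≗S (suc j) (j≢y ∘ Fin-suc-injective)

count-Without : ∀ {N} {S S′ : Subset N} (p : Fin N → Bool) {y} → S y ≡ true → Without S y S′ → p y ≡ true →
  count (λ j → S j ∧ p j) ≡ suc (count (λ j → S′ j ∧ p j))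
count-Without {suc N} {S} {S′} p {zero} Sy (S′y , S′≗S) py rewrite Sy | S′y | py =
  cong suc (count-cong λ j → cong (_∧ p (suc j)) (sym (S′≗S (suc j) λ ())))
count-Without {suc N} {S} {S′} p {suc y} Sy S′∖y py rewrite proj₂ S′∖y zero (λ ()) with S zero ∧ p zero
... | true  = cong suc (count-Without (p ∘ suc) Sy (Without-suc S′∖y) py)
... | false = count-Without (p ∘ suc) Sy (Without-suc S′∖y) py

count-Without-∉ : ∀ {N} {S S′ : Subset N} (p : Fin N → Bool) {y} → Without S y S′ → p y ≡ false →
  count (λ j → S j ∧ p j) ≡ count (λ j → S′ j ∧ p j)
count-Without-∉ {S = S} {S′} p {y} (S′y , S′≗S) py = count-cong same
  where
  same : ∀ j → (S j ∧ p j) ≡ (S′ j ∧ p j)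
  same j with j ≟ y
  ... | yes refl rewrite py = trans (∧-zeroʳ (S j)) (sym (∧-zeroʳ (S′ j)))
  ... | no j≢y = cong (_∧ p j) (sym (S′≗S j j≢y))

-- Whichever element of a part of size s is removed, the product loses one factor laterFactor (s - 1).
weight-Without : ∀ {N} {S S′ : Subset N} (f : Labelling N) {y} → S y ≡ true → Without S y S′ →
  weight S f ≡ laterFactor (count (inPart S′ f (f y))) * weight S′ f
weight-Without {suc N} {S} {S′} f {zero} Sy (S′y , S′≗S) rewrite Sy | S′y =
  cong₂ (λ k w → laterFactor k * w)
        (count-cong λ j → cong (_∧ (f (suc j) ≡ᵇ f zero)) (sym (S′≗S (suc j) λ ())))
        (trans (weight-cong-subset (f ∘ suc) λ j → sym (S′≗S (suc j) λ ())) (sym (*-identityˡ _)))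
weight-Without {suc N} {S} {S′} f {suc y} Sy S′∖y rewrite proj₂ S′∖y zero (λ ()) with S zero
... | false rewrite *-identityˡ (weight (S ∘ suc) (f ∘ suc)) | *-identityˡ (weight (S′ ∘ suc) (f ∘ suc)) =
  weight-Without (f ∘ suc) Sy (Without-suc S′∖y)
... | true rewrite weight-Without (f ∘ suc) Sy (Without-suc S′∖y)
  with f zero ≡ᵇ f (suc y) | ≡ᵇ-reflects (f zero) (f (suc y))
...   | true | ofʸ f0≡fy
  rewrite count-Without (λ j → f (suc j) ≡ᵇ f zero) Sy (Without-suc S′∖y) (≡ᵇ-true (sym f0≡fy))
        | f0≡fy = refl
...   | false | ofⁿ f0≢fy
  rewrite count-Without-∉ (λ j → f (suc j) ≡ᵇ f zero) (Without-suc S′∖y) (≡ᵇ-false (f0≢fy ∘ sym)) =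
  x∙yz≈y∙xz (laterFactor (count (inPart (S′ ∘ suc) (f ∘ suc) (f zero))))
            (laterFactor (count (inPart (S′ ∘ suc) (f ∘ suc) (f (suc y)))))
            (weight (S′ ∘ suc) (f ∘ suc))

partFactor : ℕ → ℤ
partFactor s = (-1ℤ ^ (s ∸ 1)) * + ((s ∸ 1) !)

partFactor-suc : ∀ s → partFactor (suc s) ≡ laterFactor s * partFactor s
partFactor-suc zero    = refl
partFactor-suc (suc k) =
  trans (cong ((-1ℤ * (-1ℤ ^ k)) *_) (ℤ.pos-* (suc k) (k !)))
        (solve 3 (λ s f a → (con -1ℤ :* s) :* (a :* f) := (:- a) :* (s :* f)) refl (-1ℤ ^ k) (+ (k !)) (+ suc k))
  where open +-*-Solver

firstTrue : ∀ {N} (p : Fin N → Bool) {j} → p j ≡ true →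
  ∃ λ i → p i ≡ true × (∀ i′ → toℕ i′ < toℕ i → p i′ ≡ false)
firstTrue {suc N} p {j} pj with p zero in p0
... | true = zero , p0 , λ _ ()
firstTrue {suc N} p {zero} pj | false = contradiction (trans (sym pj) p0) λ ()
firstTrue {suc N} p {suc j} pj | false with firstTrue (p ∘ suc) pj
... | i , pi , before = suc i , pi , λ { zero _ → p0 ; (suc i′) i′<i → before i′ (ℕₚ.≤-pred i′<i) }

IsLeader : ∀ {N} → Subset N → Labelling N → Fin N → Set
IsLeader S f i = S i ≡ true × ¬ ∃ λ j → S j ≡ true × f j ≡ f i × toℕ j < toℕ i

isLeader-reflects : ∀ {N} (S : Subset N) f i → Reflects (IsLeader S f i) (isLeader S f i)
isLeader-reflects S f i =
  ≡true-reflects (S i) ×-reflects ¬-reflects (any-tabulate-reflects _ id λ j →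
    ≡true-reflects (S j) ×-reflects ≡ᵇ-reflects (f j) (f i) ×-reflects ℕₚ.<ᵇ-reflects-< (toℕ j) (toℕ i))

leader-unique : ∀ {N} {S : Subset N} {f i i′} → IsLeader S f i → IsLeader S f i′ → f i ≡ f i′ → i ≡ i′
leader-unique {i = i} {i′} (Si , i-first) (Si′ , i′-first) fi≡fi′ with ℕₚ.<-cmp (toℕ i) (toℕ i′)
... | tri< i<i′ _ _ = contradiction (i , Si , fi≡fi′ , i<i′) i′-first
... | tri≈ _ i≡i′ _ = toℕ-injective i≡i′
... | tri> _ _ i′<i = contradiction (i′ , Si′ , sym fi≡fi′ , i′<i) i-first

first-isLeader : ∀ {N} (S : Subset N) f {a j} → inPart S f a j ≡ true →
  ∃ λ i → IsLeader S f i × f i ≡ a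
first-isLeader S f {a} inj with firstTrue (inPart S f a) inj
... | i , ini , before with ∧-true⁻ (S i) ini
...   | Si , fi≡ᵇa = i , (Si , earlier) , fi≡a
  where
  fi≡a : f i ≡ a
  fi≡a = reflects-true⁻ (≡ᵇ-reflects (f i) a) fi≡ᵇa
  earlier : ¬ ∃ λ j → S j ≡ true × f j ≡ f i × toℕ j < toℕ i
  earlier (j , Sj , fj≡fi , j<i) =
    contradiction (trans (sym (before j j<i)) (cong₂ _∧_ Sj (≡ᵇ-true (trans fj≡fi fi≡a)))) λ ()

isLeader-zero : ∀ {N} (S : Subset (suc N)) f → isLeader S f zero ≡ S zero
isLeader-zero S f =
  det (isLeader-reflects S f zero)
      (reflects-map (λ S0 → S0 , λ { (_ , _ , _ , ()) }) proj₁ (≡true-reflects (S zero)))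

isLeader-suc : ∀ {N} (S : Subset (suc N)) f i →
  isLeader S f (suc i) ≡ isLeader (S ∘ suc) (f ∘ suc) i ∧ not (S zero ∧ (f zero ≡ᵇ f (suc i)))
isLeader-suc S f i =
  det (reflects-map to from (isLeader-reflects S f (suc i)))
      (isLeader-reflects (S ∘ suc) (f ∘ suc) i ×-reflects ¬-reflects (≡true-reflects (S zero) ×-reflects ≡ᵇ-reflects _ _))
  where
  to : IsLeader S f (suc i) → IsLeader (S ∘ suc) (f ∘ suc) i × ¬ (S zero ≡ true × f zero ≡ f (suc i))
  to (Si , first) = (Si , λ { (j , Sj , fj≡fi , j<i) → first (suc j , Sj , fj≡fi , s≤s j<i) })
                  , λ { (S0 , f0≡fi) → first (zero , S0 , f0≡fi , s≤s z≤n) }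
  from : IsLeader (S ∘ suc) (f ∘ suc) i × ¬ (S zero ≡ true × f zero ≡ f (suc i)) → IsLeader S f (suc i)
  from ((Si , first) , not-zero) = Si , λ
    { (zero , S0 , f0≡fi , _) → not-zero (S0 , f0≡fi)
    ; (suc j , Sj , fj≡fi , j<i) → first (j , Sj , fj≡fi , ℕₚ.≤-pred j<i) }

leaderFactor : ∀ {N} → Subset N → Labelling N → Fin N → ℤ
leaderFactor S f i = if isLeader S f i then partFactor (count (inPart S f (f i))) else 1ℤ

leaderProduct : ∀ {N} → Subset N → Labelling N → ℤ
leaderProduct S f = prodℤ (tabulate (leaderFactor S f))

prodℤ-filterᵇ : ∀ {A : Set} (w : A → ℤ) (P : A → Bool) xs →
  prodℤ (map w (filterᵇ P xs)) ≡ prodℤ (map (λ x → if P x then w x else 1ℤ) xs)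
prodℤ-filterᵇ w P []       = refl
prodℤ-filterᵇ w P (x ∷ xs) with P x
... | true  = cong (w x *_) (prodℤ-filterᵇ w P xs)
... | false = trans (prodℤ-filterᵇ w P xs) (sym (*-identityˡ _))

εn≡leaderProduct : ∀ {N} (S : Subset N) f → εn S f ≡ leaderProduct S f
εn≡leaderProduct {N} S f =
  trans (prodℤ-filterᵇ (λ i → partFactor (partSize S f i)) (isLeader S f) (allFin N))
        (cong prodℤ (trans (map-tabulate id _)
                           (tabulate-cong λ i → cong (λ k → if isLeader S f i then partFactor k else 1ℤ)
                                                     (countᵇ≡count (inPart S f (f i))))))

prodℤ-tabulate-single : ∀ {N} (g : Fin N → ℤ) i₀ →
  prodℤ (tabulate g) ≡ g i₀ * prodℤ (tabulate λ i → if does (i ≟ i₀) then 1ℤ else g i)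
prodℤ-tabulate-single {suc N} g zero     = cong (g zero *_) (sym (*-identityˡ _))
prodℤ-tabulate-single {suc N} g (suc i₀) =
  trans (cong (g zero *_) (prodℤ-tabulate-single (g ∘ suc) i₀)) (x∙yz≈y∙xz (g zero) (g (suc i₀)) _)

-- partFactor 0 = 1, so this also holds when no element of S has label a.
leaderProduct-factor : ∀ {N} (S : Subset N) f a →
  leaderProduct S f ≡ partFactor (count (inPart S f a)) *
    prodℤ (tabulate λ i → if isLeader S f i ∧ not (a ≡ᵇ f i) then partFactor (count (inPart S f (f i))) else 1ℤ)
leaderProduct-factor S f a with count (inPart S f a) in #a
... | zero = trans (cong prodℤ (tabulate-cong others)) (sym (*-identityˡ _))
  where
  a≢leader : ∀ i → isLeader S f i ≡ true → a ≢ f i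
  a≢leader i lead a≡fi = contradiction
    (trans (sym (count≡0⇒ #a i))
           (cong₂ _∧_ (proj₁ (reflects-true⁻ (isLeader-reflects S f i) lead)) (≡ᵇ-true (sym a≡fi))))
    λ ()
  others : ∀ i → leaderFactor S f i
               ≡ (if isLeader S f i ∧ not (a ≡ᵇ f i) then partFactor (count (inPart S f (f i))) else 1ℤ)
  others i with isLeader S f i in lead
  ... | false = refl
  ... | true  rewrite ≡ᵇ-false (a≢leader i lead) = refl
... | suc k with count≡suc⇒ {p = inPart S f a} #a
...   | j , j∈a with first-isLeader S f j∈a
...     | i* , lead* , fi*≡a =
  trans (prodℤ-tabulate-single (leaderFactor S f) i*) (cong₂ _*_ factor* (cong prodℤ (tabulate-cong others)))
  where
  factor* : leaderFactor S f i* ≡ partFactor (suc k)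
  factor* rewrite reflects-true⁺ (isLeader-reflects S f i*) lead* =
    cong partFactor (trans (cong (count ∘ inPart S f) fi*≡a) #a)
  others : ∀ i → (if does (i ≟ i*) then 1ℤ else leaderFactor S f i)
               ≡ (if isLeader S f i ∧ not (a ≡ᵇ f i) then partFactor (count (inPart S f (f i))) else 1ℤ)
  others i with i ≟ i*
  ... | yes refl rewrite ≡ᵇ-true (sym fi*≡a) | ∧-zeroʳ (isLeader S f i) = refl
  ... | no i≢i* with isLeader S f i in lead
  ...   | false = refl
  ...   | true  rewrite ≡ᵇ-false {a} {f i} λ a≡fi →
                    i≢i* (leader-unique (reflects-true⁻ (isLeader-reflects S f i) lead) lead*
                                        (trans (sym a≡fi) (sym fi*≡a))) = refl

leaderProduct-suc : ∀ {N} (S : Subset (suc N)) f →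
  leaderProduct S f ≡ firstFactor S f * leaderProduct (S ∘ suc) (f ∘ suc)
leaderProduct-suc {N} S f =
  trans (cong₂ _*_ head (cong prodℤ (tabulate-cong tail))) (split (S zero))
  where
  L₀ : ℕ
  L₀ = count (inPart (S ∘ suc) (f ∘ suc) (f zero))
  restFactor : Bool → Fin N → ℤ
  restFactor b i = if isLeader (S ∘ suc) (f ∘ suc) i ∧ not (b ∧ (f zero ≡ᵇ f (suc i)))
                   then partFactor (count (inPart (S ∘ suc) (f ∘ suc) (f (suc i)))) else 1ℤ
  head : leaderFactor S f zero ≡ (if S zero then partFactor (suc L₀) else 1ℤ)
  head rewrite isLeader-zero S f | ≡ᵇ-refl (f zero) with S zero
  ... | true  = refl
  ... | false = refl
  tail : ∀ i → leaderFactor S f (suc i) ≡ restFactor (S zero) i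
  tail i rewrite isLeader-suc S f i with S zero ∧ (f zero ≡ᵇ f (suc i))
  ... | true  rewrite ∧-zeroʳ (isLeader (S ∘ suc) (f ∘ suc) i) = refl
  ... | false rewrite ∧-identityʳ (isLeader (S ∘ suc) (f ∘ suc) i) = refl
  split : ∀ b → (if b then partFactor (suc L₀) else 1ℤ) * prodℤ (tabulate (restFactor b))
              ≡ (if b then laterFactor L₀ else 1ℤ) * leaderProduct (S ∘ suc) (f ∘ suc)
  split false = cong (1ℤ *_) (cong prodℤ (tabulate-cong λ i →
    cong (λ b → if b then partFactor (count (inPart (S ∘ suc) (f ∘ suc) (f (suc i)))) else 1ℤ)
         (∧-identityʳ (isLeader (S ∘ suc) (f ∘ suc) i))))
  split true = begin
    partFactor (suc L₀) * rest                   ≡⟨ cong (_* rest) (partFactor-suc L₀) ⟩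
    laterFactor L₀ * partFactor L₀ * rest        ≡⟨ *-assoc (laterFactor L₀) (partFactor L₀) rest ⟩
    laterFactor L₀ * (partFactor L₀ * rest)
      ≡⟨ cong (laterFactor L₀ *_) (sym (leaderProduct-factor (S ∘ suc) (f ∘ suc) (f zero))) ⟩
    laterFactor L₀ * leaderProduct (S ∘ suc) (f ∘ suc) ∎
    where
    open ≡-Reasoning
    rest : ℤ
    rest = prodℤ (tabulate (restFactor true))

leaderProduct≡weight : ∀ {N} (S : Subset N) f → leaderProduct S f ≡ weight S f
leaderProduct≡weight {zero}  S f = refl
leaderProduct≡weight {suc N} S f =
  trans (leaderProduct-suc S f) (cong (firstFactor S f *_) (leaderProduct≡weight (S ∘ suc) (f ∘ suc)))

εn≡weight : ∀ {N} (S : Subset N) f → εn S f ≡ weight S f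
εn≡weight S f = trans (εn≡leaderProduct S f) (leaderProduct≡weight S f)

-- Every partition is enumerated once

IsIndicator : ∀ {A : Set} → (A → Set) → ℤ → (A → ℤ) → Set
IsIndicator P z F = (∀ x → P x → F x ≡ z) × (∀ x → ¬ P x → F x ≡ 0ℤ)

IsIndicator-∘ : ∀ {A B : Set} {P : A → Set} {Q : B → Set} {z F} (g : B → A) →
  (∀ x → P (g x) → Q x) → (∀ x → Q x → P (g x)) → IsIndicator P z F → IsIndicator Q z (F ∘ g)
IsIndicator-∘ g to from (onP , offP) = (λ x Qx → onP (g x) (from x Qx)) , (λ x ¬Qx → offP (g x) (¬Qx ∘ to x))

InjectiveBelow : ℕ → (ℕ → ℕ) → Set
InjectiveBelow k ρ = ∀ a b → a < k → b < k → ρ a ≡ ρ b → a ≡ b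

-- Invariant of rgs N S k: a fixed prefix has opened k parts, and label a < k names the part of π
-- labelled ρ a.
Represents : ∀ {N} → Subset N → ℕ → (ℕ → ℕ) → Labelling N → Labelling N → Set
Represents S k ρ π f = SameOn S f π × (∀ i → S i ≡ true → ∀ a → a < k → (f i ≡ᵇ a) ≡ (π i ≡ᵇ ρ a))

Represents-skip : ∀ {N} {S : Subset (suc N)} {k ρ π a} {f : Labelling N} → S zero ≡ false →
  Represents S k ρ π (a VF.∷ f) → Represents (S ∘ suc) k ρ (π ∘ suc) f
Represents-skip S0 (same , labels) = (λ i j → same (suc i) (suc j)) , labels ∘ suc

Represents-unskip : ∀ {N} {S : Subset (suc N)} {k ρ π a} {f : Labelling N} → S zero ≡ false →
  Represents (S ∘ suc) k ρ (π ∘ suc) f → Represents S k ρ π (a VF.∷ f)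
Represents-unskip {S = S} {k} {ρ} {π} {a} {f} S0 (same , labels) = same′ , labels′
  where
  S0≢true : S zero ≢ true
  S0≢true S0≡true = contradiction (trans (sym S0) S0≡true) λ ()
  same′ : SameOn S (a VF.∷ f) π
  same′ zero    _       S0′ _   = contradiction S0′ S0≢true
  same′ (suc i) zero    _   S0′ = contradiction S0′ S0≢true
  same′ (suc i) (suc j) Si  Sj  = same i j Si Sj
  labels′ : ∀ i → S i ≡ true → ∀ b → b < k → ((a VF.∷ f) i ≡ᵇ b) ≡ (π i ≡ᵇ ρ b)
  labels′ zero    S0′ = contradiction S0′ S0≢true
  labels′ (suc i) Si  = labels i Si

≡ᵇ-injective : ∀ {k} {ρ : ℕ → ℕ} → InjectiveBelow k ρ → ∀ {a b} → a < k → b < k →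
  (a ≡ᵇ b) ≡ (ρ a ≡ᵇ ρ b)
≡ᵇ-injective {ρ = ρ} inj {a} {b} a<k b<k =
  det (≡ᵇ-reflects a b) (reflects-map (inj a b a<k b<k) (cong _) (≡ᵇ-reflects (ρ a) (ρ b)))

module RepresentsCons {N} {S : Subset (suc N)} (S0 : S zero ≡ true) (k : ℕ) (ρ : ℕ → ℕ) (π : Labelling (suc N)) where

  HeadAgrees : ℕ → Labelling N → Set
  HeadAgrees a f = (∀ j → S (suc j) ≡ true → (f j ≡ᵇ a) ≡ (π (suc j) ≡ᵇ π zero))
                 × (∀ b → b < k → (a ≡ᵇ b) ≡ (π zero ≡ᵇ ρ b))

  Represents-∷⁻ : ∀ {a f} → Represents S k ρ π (a VF.∷ f) → Represents (S ∘ suc) k ρ (π ∘ suc) f × HeadAgrees a f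
  Represents-∷⁻ (same , labels) =
    ((λ i j → same (suc i) (suc j)) , labels ∘ suc) , (λ j Sj → same (suc j) zero Sj S0) , labels zero S0

  Represents-∷⁺ : ∀ {a f} → Represents (S ∘ suc) k ρ (π ∘ suc) f → HeadAgrees a f → Represents S k ρ π (a VF.∷ f)
  Represents-∷⁺ {a} {f} (same , labels) (tail , head) = same′ , labels′
    where
    same′ : SameOn S (a VF.∷ f) π
    same′ zero    zero    _  _  = trans (≡ᵇ-refl a) (sym (≡ᵇ-refl (π zero)))
    same′ zero    (suc j) _  Sj = trans (≡ᵇ-sym a (f j)) (trans (tail j Sj) (≡ᵇ-sym (π (suc j)) (π zero)))
    same′ (suc i) zero    Si _  = tail i Si
    same′ (suc i) (suc j) Si Sj = same i j Si Sj
    labels′ : ∀ i → S i ≡ true → ∀ b → b < k → ((a VF.∷ f) i ≡ᵇ b) ≡ (π i ≡ᵇ ρ b)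
    labels′ zero    _  = head
    labels′ (suc i) Si = labels i Si

  head-opened : ∀ {a f} → Represents S k ρ π (a VF.∷ f) → a < k → π zero ≡ ρ a
  head-opened {a} rep a<k =
    reflects-true⁻ (≡ᵇ-reflects (π zero) (ρ a))
      (trans (sym (proj₂ (proj₂ (Represents-∷⁻ rep)) a a<k)) (≡ᵇ-refl a))

  head-label : ∀ {a f b} → Represents S k ρ π (a VF.∷ f) → b < k → π zero ≡ ρ b → a ≡ b
  head-label {a} {b = b} rep b<k π0≡ρb =
    reflects-true⁻ (≡ᵇ-reflects a b)
      (trans (proj₂ (proj₂ (Represents-∷⁻ rep)) b b<k) (≡ᵇ-true π0≡ρb))

  Represents-old : InjectiveBelow k ρ → ∀ {b f} → b < k → π zero ≡ ρ b →
    Represents (S ∘ suc) k ρ (π ∘ suc) f → Represents S k ρ π (b VF.∷ f)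
  Represents-old inj {b} {f} b<k π0≡ρb rep@(_ , labels) = Represents-∷⁺ rep (tail , head)
    where
    tail : ∀ j → S (suc j) ≡ true → (f j ≡ᵇ b) ≡ (π (suc j) ≡ᵇ π zero)
    tail j Sj = trans (labels j Sj b b<k) (cong (π (suc j) ≡ᵇ_) (sym π0≡ρb))
    head : ∀ b′ → b′ < k → (b ≡ᵇ b′) ≡ (π zero ≡ᵇ ρ b′)
    head b′ b′<k = trans (≡ᵇ-injective inj b<k b′<k) (cong (_≡ᵇ ρ b′) (sym π0≡ρb))

  ρ⁺ : ℕ → ℕ
  ρ⁺ b = if b ≡ᵇ k then π zero else ρ b

  ρ⁺-< : ∀ {b} → b < k → ρ⁺ b ≡ ρ b
  ρ⁺-< b<k rewrite ≡ᵇ-false (ℕₚ.<⇒≢ b<k) = refl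

  ρ⁺-k : ρ⁺ k ≡ π zero
  ρ⁺-k rewrite ≡ᵇ-refl k = refl

  module FreshPart (fresh : ∀ b → b < k → π zero ≢ ρ b) where

    InjectiveBelow-ρ⁺ : InjectiveBelow k ρ → InjectiveBelow (suc k) ρ⁺
    InjectiveBelow-ρ⁺ inj a b a<1+k b<1+k ρ⁺a≡ρ⁺b
      with ℕₚ.m<1+n⇒m<n∨m≡n a<1+k | ℕₚ.m<1+n⇒m<n∨m≡n b<1+k
    ... | inj₁ a<k  | inj₁ b<k  = inj a b a<k b<k (trans (sym (ρ⁺-< a<k)) (trans ρ⁺a≡ρ⁺b (ρ⁺-< b<k)))
    ... | inj₁ a<k  | inj₂ refl = contradiction (trans (sym ρ⁺-k) (trans (sym ρ⁺a≡ρ⁺b) (ρ⁺-< a<k))) (fresh a a<k)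
    ... | inj₂ refl | inj₁ b<k  = contradiction (trans (sym ρ⁺-k) (trans ρ⁺a≡ρ⁺b (ρ⁺-< b<k))) (fresh b b<k)
    ... | inj₂ refl | inj₂ refl = refl

    Represents-new⁻ : ∀ {f} → Represents S k ρ π (k VF.∷ f) → Represents (S ∘ suc) (suc k) ρ⁺ (π ∘ suc) f
    Represents-new⁻ {f} rep with Represents-∷⁻ rep
    ... | (same , labels) , tail , _ = same , labels⁺
      where
      labels⁺ : ∀ i → S (suc i) ≡ true → ∀ b → b < suc k → (f i ≡ᵇ b) ≡ (π (suc i) ≡ᵇ ρ⁺ b)
      labels⁺ i Si b b<1+k with ℕₚ.m<1+n⇒m<n∨m≡n b<1+k
      ... | inj₁ b<k  = trans (labels i Si b b<k) (cong (π (suc i) ≡ᵇ_) (sym (ρ⁺-< b<k)))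
      ... | inj₂ refl = trans (tail i Si) (cong (π (suc i) ≡ᵇ_) (sym ρ⁺-k))

    Represents-new⁺ : ∀ {f} → Represents (S ∘ suc) (suc k) ρ⁺ (π ∘ suc) f → Represents S k ρ π (k VF.∷ f)
    Represents-new⁺ {f} (same , labels⁺) = Represents-∷⁺ (same , labels) (tail , head)
      where
      labels : ∀ i → S (suc i) ≡ true → ∀ b → b < k → (f i ≡ᵇ b) ≡ (π (suc i) ≡ᵇ ρ b)
      labels i Si b b<k = trans (labels⁺ i Si b (ℕₚ.m<n⇒m<1+n b<k)) (cong (π (suc i) ≡ᵇ_) (ρ⁺-< b<k))
      tail : ∀ j → S (suc j) ≡ true → (f j ≡ᵇ k) ≡ (π (suc j) ≡ᵇ π zero)
      tail j Sj = trans (labels⁺ j Sj k (ℕₚ.n<1+n k)) (cong (π (suc j) ≡ᵇ_) ρ⁺-k)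
      head : ∀ b → b < k → (k ≡ᵇ b) ≡ (π zero ≡ᵇ ρ b)
      head b b<k = trans (≡ᵇ-false (ℕₚ.<⇒≢ b<k ∘ sym)) (sym (≡ᵇ-false (fresh b b<k)))

∑-rgs : ∀ N (S : Subset N) k ρ π {F : Labelling N → ℤ} {z} → InjectiveBelow k ρ →
  IsIndicator (Represents S k ρ π) z F → ∑ F (rgs N S k) ≡ z
∑-rgs zero    S k ρ π inj (onP , _) = trans (+-identityʳ _) (onP VF.[] ((λ ()) , (λ ())))
∑-rgs (suc N) S k ρ π {F} {z} inj ind with S zero in S0
... | false =
  trans (∑-map F (0 VF.∷_) (rgs N (S ∘ suc) k))
        (∑-rgs N (S ∘ suc) k ρ (π ∘ suc) inj
           (IsIndicator-∘ {Q = Represents (S ∘ suc) k ρ (π ∘ suc)} (0 VF.∷_)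
              (λ _ → Represents-skip {k = k} {ρ} {π} S0) (λ _ → Represents-unskip {k = k} {ρ} {π} S0) ind))
... | true = trans (∑-concatMap F (λ a → map (a VF.∷_) (tails a)) (upTo (suc k)))
                  (trans (∑-cong (λ a → ∑-map F (a VF.∷_) (tails a)) (upTo (suc k))) pick)
  where
  open RepresentsCons {S = S} S0 k ρ π
  tails : ℕ → List (Labelling N)
  tails a = rgs N (S ∘ suc) (if a ≡ᵇ k then suc k else k)
  T : ℕ → ℤ
  T a = ∑ (F ∘ (a VF.∷_)) (tails a)
  vanishes : ∀ a → (∀ f → ¬ Represents S k ρ π (a VF.∷ f)) → T a ≡ 0ℤ
  vanishes a ¬rep = ∑-zero (λ f → proj₂ ind (a VF.∷ f) (¬rep f)) (tails a)
  pick : ∑ T (upTo (suc k)) ≡ z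
  pick with any? (λ b → π zero ℕₚ.≟ ρ (toℕ b))
  ... | yes (b , π0≡ρb) =
    trans (∑-applyUpTo-single T id (suc k) (toℕ b) (ℕₚ.m<n⇒m<1+n (toℕ<n b)) others) chosen
    where
    others : ∀ a → a < suc k → a ≢ toℕ b → T a ≡ 0ℤ
    others a _ a≢b = vanishes a λ f rep → a≢b (head-label rep (toℕ<n b) π0≡ρb)
    chosen : T (toℕ b) ≡ z
    chosen rewrite ≡ᵇ-false (ℕₚ.<⇒≢ (toℕ<n b)) =
      ∑-rgs N (S ∘ suc) k ρ (π ∘ suc) inj
        (IsIndicator-∘ (toℕ b VF.∷_) (λ _ → proj₁ ∘ Represents-∷⁻)
                                     (λ _ → Represents-old inj (toℕ<n b) π0≡ρb) ind)
  ... | no ¬old = trans (∑-applyUpTo-single T id (suc k) k (ℕₚ.n<1+n k) others) chosen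
    where
    fresh : ∀ b → b < k → π zero ≢ ρ b
    fresh b b<k π0≡ρb = ¬old (fromℕ< b<k , trans π0≡ρb (cong ρ (sym (toℕ-fromℕ< b<k))))
    open FreshPart fresh
    others : ∀ a → a < suc k → a ≢ k → T a ≡ 0ℤ
    others a a<1+k a≢k with ℕₚ.m<1+n⇒m<n∨m≡n a<1+k
    ... | inj₁ a<k  = vanishes a λ f rep → fresh a a<k (head-opened rep a<k)
    ... | inj₂ a≡k  = contradiction a≡k a≢k
    chosen : T k ≡ z
    chosen rewrite ≡ᵇ-refl k =
      ∑-rgs N (S ∘ suc) (suc k) ρ⁺ (π ∘ suc) (InjectiveBelow-ρ⁺ inj)
        (IsIndicator-∘ (k VF.∷_) (λ _ → Represents-new⁻) (λ _ → Represents-new⁺) ind)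

∑-partitions : ∀ {N} (S : Subset N) π {F : Labelling N → ℤ} {z} →
  IsIndicator (λ f → SameOn S f π) z F → ∑ F (partitions S) ≡ z
∑-partitions {N} S π ind =
  ∑-rgs N S 0 (λ _ → 0) π (λ _ _ ())
    (IsIndicator-∘ {Q = Represents S 0 (λ _ → 0) π} id (λ _ same → same , λ _ _ _ ()) (λ _ → proj₁) ind)

-- Coefficients of pullbacks and products

Compatible : ∀ {N} → (Fin N → Fin N) → Labelling N → Set
Compatible g π = ∀ i → π (g i) ≡ π i

compatible? : ∀ {N} (g : Fin N → Fin N) π → Dec (Compatible g π)
compatible? g π = all? λ i → π (g i) ℕₚ.≟ π i

IsRetractionOnto : ∀ {N} → Subset N → (Fin N → Fin N) → Set
IsRetractionOnto S g = (∀ i → S (g i) ≡ true) × (∀ i → S i ≡ true → g i ≡ i)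

module _ {N} {S : Subset N} {g : Fin N → Fin N} (retraction : IsRetractionOnto S g) where

  private
    g∈S : ∀ i → S (g i) ≡ true
    g∈S = proj₁ retraction
    g-fixes : ∀ i → S i ≡ true → g i ≡ i
    g-fixes = proj₂ retraction

  SamePartition-∘⁻ : ∀ {f π} → SamePartition (f ∘ g) π → Compatible g π × SameOn S f π
  SamePartition-∘⁻ {f} {π} sp = compatible , same
    where
    compatible : Compatible g π
    compatible i = reflects-true⁻ (≡ᵇ-reflects (π (g i)) (π i))
      (trans (sym (sp (g i) i)) (trans (cong (λ j → f j ≡ᵇ f (g i)) (g-fixes (g i) (g∈S i))) (≡ᵇ-refl (f (g i)))))
    same : SameOn S f π
    same i j Si Sj = trans (cong₂ (λ i′ j′ → f i′ ≡ᵇ f j′) (sym (g-fixes i Si)) (sym (g-fixes j Sj))) (sp i j)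

  SamePartition-∘⁺ : ∀ {f π} → Compatible g π → SameOn S f π → SamePartition (f ∘ g) π
  SamePartition-∘⁺ {f} {π} compatible same i j =
    trans (same (g i) (g j) (g∈S i) (g∈S j)) (cong₂ _≡ᵇ_ (compatible i) (compatible j))

  coeff-pullback-χ : ∀ π → coeff (pullback g (χ S)) π ≡ (if does (compatible? g π) then weight S π else 0ℤ)
  coeff-pullback-χ π =
    trans (∑-map _ _ (map (λ f → εn S f , f) (partitions S)))
          (trans (∑-map _ _ (partitions S)) (∑-partitions S π (on , off)))
    where
    on : ∀ f → SameOn S f π → (if samePartition (f ∘ g) π then εn S f else 0ℤ)
                            ≡ (if does (compatible? g π) then weight S π else 0ℤ)
    on f same = decide (compatible? g π)
      where
      decide : (c? : Dec (Compatible g π)) →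
        (if samePartition (f ∘ g) π then εn S f else 0ℤ) ≡ (if does c? then weight S π else 0ℤ)
      decide (yes compatible) = trans (samePartition-true (f ∘ g) π (SamePartition-∘⁺ {f} {π} compatible same))
                                      (trans (εn≡weight S f) (weight-cong S same))
      decide (no ¬compatible) = samePartition-false (f ∘ g) π (¬compatible ∘ proj₁ ∘ SamePartition-∘⁻ {f} {π})
    off : ∀ f → ¬ SameOn S f π → (if samePartition (f ∘ g) π then εn S f else 0ℤ) ≡ 0ℤ
    off f ¬same = samePartition-false (f ∘ g) π (¬same ∘ proj₂ ∘ SamePartition-∘⁻ {f} {π})

data SumView (m n : ℕ) : Fin (m ℕ.+ n) → Set where
  left  : ∀ x → SumView m n (x ↑ˡ n)
  right : ∀ y → SumView m n (m ↑ʳ y)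

sumView : ∀ m n i → SumView m n i
sumView m n i with splitAt m i in eq
... | inj₁ x = subst (SumView m n) (splitAt⁻¹-↑ˡ eq) (left x)
... | inj₂ y = subst (SumView m n) (splitAt⁻¹-↑ʳ eq) (right y)

even≢odd : ∀ a b → 2 ℕ.* a ≢ suc (2 ℕ.* b)
even≢odd zero    b       ()
even≢odd (suc a) zero    2+2a≡1 = contradiction (ℕₚ.suc-injective (trans (sym (ℕₚ.*-suc 2 a)) 2+2a≡1)) λ ()
even≢odd (suc a) (suc b) 2+2a≡3+2b =
  even≢odd a b (ℕₚ.suc-injective (ℕₚ.suc-injective
    (trans (sym (ℕₚ.*-suc 2 a)) (trans 2+2a≡3+2b (cong suc (ℕₚ.*-suc 2 b))))))

≡ᵇ-double : ∀ a b → (2 ℕ.* a ≡ᵇ 2 ℕ.* b) ≡ (a ≡ᵇ b)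
≡ᵇ-double a b =
  det (reflects-map (ℕₚ.*-cancelˡ-≡ a b 2) (cong (2 ℕ.*_)) (≡ᵇ-reflects (2 ℕ.* a) (2 ℕ.* b))) (≡ᵇ-reflects a b)

Separated : ∀ {m n} → Labelling (m ℕ.+ n) → Set
Separated {m} {n} π = ∀ x y → π (x ↑ˡ n) ≢ π (m ↑ʳ y)

separated? : ∀ {m n} (π : Labelling (m ℕ.+ n)) → Dec (Separated π)
separated? {m} {n} π = all? λ x → all? λ y → ¬? (π (x ↑ˡ n) ℕₚ.≟ π (m ↑ʳ y))

separated-suc : ∀ {m n} (π : Labelling (suc m ℕ.+ n)) →
  Separated {suc m} {n} π ⇔ ((∀ y → π zero ≢ π (suc (m ↑ʳ y))) × Separated {m} {n} (π ∘ suc))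
separated-suc π = mk⇔ (λ s → s zero , s ∘ suc) (λ { (s₀ , s′) zero → s₀ ; (s₀ , s′) (suc x) → s′ x })

module _ {m n} (f : Labelling m) (h : Labelling n) where

  mulPart-↑ˡ : ∀ x → mulPart f h (x ↑ˡ n) ≡ 2 ℕ.* f x
  mulPart-↑ˡ x rewrite splitAt-↑ˡ m x n = refl

  mulPart-↑ʳ : ∀ y → mulPart f h (m ↑ʳ y) ≡ suc (2 ℕ.* h y)
  mulPart-↑ʳ y rewrite splitAt-↑ʳ m n y = refl

  SamePartition-mulPart⁻ : ∀ π → SamePartition (mulPart f h) π →
    Separated π × SamePartition f (π ∘ (_↑ˡ n)) × SamePartition h (π ∘ (m ↑ʳ_))
  SamePartition-mulPart⁻ π sp = separated , sameˡ , sameʳ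
    where
    separated : Separated π
    separated x y πx≡πy = contradiction
      (trans (sym (≡ᵇ-false (even≢odd (f x) (h y))))
             (trans (cong₂ _≡ᵇ_ (sym (mulPart-↑ˡ x)) (sym (mulPart-↑ʳ y)))
                    (trans (sp (x ↑ˡ n) (m ↑ʳ y)) (≡ᵇ-true πx≡πy))))
      λ ()
    sameˡ : SamePartition f (π ∘ (_↑ˡ n))
    sameˡ x x′ = trans (sym (≡ᵇ-double (f x) (f x′)))
                       (trans (cong₂ _≡ᵇ_ (sym (mulPart-↑ˡ x)) (sym (mulPart-↑ˡ x′))) (sp (x ↑ˡ n) (x′ ↑ˡ n)))
    sameʳ : SamePartition h (π ∘ (m ↑ʳ_))
    sameʳ y y′ = trans (sym (≡ᵇ-double (h y) (h y′)))
                       (trans (cong₂ _≡ᵇ_ (sym (mulPart-↑ʳ y)) (sym (mulPart-↑ʳ y′))) (sp (m ↑ʳ y) (m ↑ʳ y′)))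

  SamePartition-mulPart⁺ : ∀ π → Separated π → SamePartition f (π ∘ (_↑ˡ n)) → SamePartition h (π ∘ (m ↑ʳ_)) →
    SamePartition (mulPart f h) π
  SamePartition-mulPart⁺ π separated sameˡ sameʳ i j with sumView m n i | sumView m n j
  ... | left x  | left x′ rewrite mulPart-↑ˡ x | mulPart-↑ˡ x′ = trans (≡ᵇ-double (f x) (f x′)) (sameˡ x x′)
  ... | right y | right y′ rewrite mulPart-↑ʳ y | mulPart-↑ʳ y′ = trans (≡ᵇ-double (h y) (h y′)) (sameʳ y y′)
  ... | left x  | right y rewrite mulPart-↑ˡ x | mulPart-↑ʳ y =
    trans (≡ᵇ-false (even≢odd (f x) (h y))) (sym (≡ᵇ-false (separated x y)))
  ... | right y | left x rewrite mulPart-↑ʳ y | mulPart-↑ˡ x =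
    trans (≡ᵇ-false (even≢odd (f x) (h y) ∘ sym)) (sym (≡ᵇ-false (separated x y ∘ sym)))

productTerm : ∀ {m n} → Labelling (m ℕ.+ n) → Labelling m → Labelling n → ℤ
productTerm π f h = if samePartition (mulPart f h) π then εn full f * εn full h else 0ℤ

∑∑-productTerm-separated : ∀ {m n} (π : Labelling (m ℕ.+ n)) → Separated {m} {n} π →
  ∑ (λ f → ∑ (productTerm {m} {n} π f) (partitions full)) (partitions full)
    ≡ weight full (π ∘ (_↑ˡ n)) * weight full (π ∘ (m ↑ʳ_))
∑∑-productTerm-separated {m} {n} π separated = ∑-partitions full πˡ (on , off)
  where
  πˡ : Labelling m
  πˡ = π ∘ (_↑ˡ n)
  πʳ : Labelling n
  πʳ = π ∘ (m ↑ʳ_)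
  on : ∀ f → SameOn full f πˡ → ∑ (productTerm {m} {n} π f) (partitions full) ≡ weight full πˡ * weight full πʳ
  on f sameˡ = trans (∑-partitions full πʳ (onʳ , offʳ))
                     (cong (_* weight full πʳ) (trans (εn≡weight full f) (weight-cong full sameˡ)))
    where
    onʳ : ∀ h → SameOn full h πʳ → productTerm {m} {n} π f h ≡ εn full f * weight full πʳ
    onʳ h sameʳ = trans (samePartition-true (mulPart f h) π
                          (SamePartition-mulPart⁺ f h π separated (λ i j → sameˡ i j refl refl) (λ i j → sameʳ i j refl refl)))
                        (cong (εn full f *_) (trans (εn≡weight full h) (weight-cong full sameʳ)))
    offʳ : ∀ h → ¬ SameOn full h πʳ → productTerm {m} {n} π f h ≡ 0ℤ
    offʳ h ¬sameʳ = samePartition-false (mulPart f h) π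
      (λ sp → ¬sameʳ λ i j _ _ → proj₂ (proj₂ (SamePartition-mulPart⁻ f h π sp)) i j)
  off : ∀ f → ¬ SameOn full f πˡ → ∑ (productTerm {m} {n} π f) (partitions full) ≡ 0ℤ
  off f ¬sameˡ = ∑-zero (λ h → samePartition-false (mulPart f h) π
                                 (λ sp → ¬sameˡ λ i j _ _ → proj₁ (proj₂ (SamePartition-mulPart⁻ f h π sp)) i j))
                        (partitions full)

productCoeff : ∀ m n → Labelling (m ℕ.+ n) → ℤ
productCoeff m n π = if does (separated? {m} {n} π) then weight full (π ∘ (_↑ˡ n)) * weight full (π ∘ (m ↑ʳ_)) else 0ℤ

coeff-χ⊛χ : ∀ m n π → coeff (χ {m} full ⊛ χ {n} full) π ≡ productCoeff m n π
coeff-χ⊛χ m n π =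
  trans (∑-concatMap _ _ (map (λ f → εn full f , f) Pm))
    (trans (∑-map _ _ Pm)
      (trans (∑-cong inner Pm) (decide (separated? {m} {n} π))))
  where
  Pm : List (Labelling m)
  Pm = partitions full
  Pn : List (Labelling n)
  Pn = partitions full
  inner : ∀ f → coeff (map (λ { (d , σ) → (εn full f * d , mulPart f σ) }) (χ {n} full)) π
              ≡ ∑ (productTerm {m} {n} π f) Pn
  inner f = trans (∑-map _ _ (map (λ h → εn full h , h) Pn)) (∑-map _ _ Pn)
  decide : (s? : Dec (Separated {m} {n} π)) →
    ∑ (λ f → ∑ (productTerm {m} {n} π f) Pn) Pm
      ≡ (if does s? then weight full (π ∘ (_↑ˡ n)) * weight full (π ∘ (m ↑ʳ_)) else 0ℤ)
  decide (yes separated)  = ∑∑-productTerm-separated π separated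
  decide (no ¬separated) =
    ∑-zero (λ f → ∑-zero (λ h → samePartition-false (mulPart f h) π
                                  (¬separated ∘ proj₁ ∘ SamePartition-mulPart⁻ f h π)) Pn) Pm

-- Partial pairings

Pairing : ℕ → ℕ → Set
Pairing m n = Fin m → Maybe (Fin n)

hits-reflects : ∀ {n} (a : Maybe (Fin n)) y → Reflects (a ≡ just y) (hits a y)
hits-reflects nothing  y = ofⁿ λ ()
hits-reflects (just z) y = reflects-map (cong just) just-injective (proof (z ≟ y))

hits-self : ∀ {n} (y : Fin n) → hits (just y) y ≡ true
hits-self y = reflects-true⁺ (hits-reflects (just y) y) refl

Unpaired : ∀ {m n} → Pairing m n → Fin n → Set
Unpaired φ y = ∀ x → φ x ≢ just y

data PreimageView {m n} (φ : Pairing m n) (y : Fin n) : Maybe (Fin m) → Set where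
  paired   : ∀ {x} → φ x ≡ just y → PreimageView φ y (just x)
  unpaired : Unpaired φ y → PreimageView φ y nothing

preimageView : ∀ {m n} (φ : Pairing m n) y → PreimageView φ y (preimage φ y)
preimageView {zero}  φ y = unpaired λ ()
preimageView {suc m} φ y with hits (φ zero) y | hits-reflects (φ zero) y
... | true  | ofʸ φ0≡y = paired φ0≡y
... | false | ofⁿ φ0≢y with preimage (φ ∘ suc) y | preimageView (φ ∘ suc) y
...   | just x  | paired φx≡y  = paired φx≡y
...   | nothing | unpaired φ≢y = unpaired λ { zero → φ0≢y ; (suc x) → φ≢y x }

unpairedᵇ : ∀ {m n} → Pairing m n → Fin n → Bool
unpairedᵇ φ y = not (is-just (preimage φ y))

unpaired-reflects : ∀ {m n} (φ : Pairing m n) y → Reflects (Unpaired φ y) (unpairedᵇ φ y)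
unpaired-reflects φ y with preimage φ y | preimageView φ y
... | just x  | paired φx≡y  = ofⁿ λ φ≢y → φ≢y x φx≡y
... | nothing | unpaired φ≢y = ofʸ φ≢y

preimage-Unpaired : ∀ {m n} (φ : Pairing m n) {y} → Unpaired φ y → preimage φ y ≡ nothing
preimage-Unpaired φ {y} y-free with preimage φ y | preimageView φ y
... | just x  | paired φx≡y = contradiction φx≡y (y-free x)
... | nothing | _           = refl

InjectivePartial : ∀ {m n} → Pairing m n → Set
InjectivePartial φ = ∀ x x′ {y} → φ x ≡ just y → φ x′ ≡ just y → x ≡ x′

isInjectivePartial-reflects : ∀ {m n} (φ : Pairing m n) → Reflects (InjectivePartial φ) (isInjectivePartial φ)
isInjectivePartial-reflects φ = all-tabulate-reflects _ id λ x → all-tabulate-reflects _ id λ x′ →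
  reflects-map (to x x′) (from x x′)
    (proof (x ≟ x′) ⊎-reflects
       ¬-reflects (any-tabulate-reflects _ id λ y → hits-reflects (φ x) y ×-reflects hits-reflects (φ x′) y))
  where
  to : ∀ x x′ → x ≡ x′ ⊎ ¬ (∃ λ y → φ x ≡ just y × φ x′ ≡ just y) →
       ∀ {y} → φ x ≡ just y → φ x′ ≡ just y → x ≡ x′
  to x x′ (inj₁ x≡x′)  _   _    = x≡x′
  to x x′ (inj₂ ¬both) φx≡y φx′≡y = contradiction (_ , φx≡y , φx′≡y) ¬both
  from : ∀ x x′ → (∀ {y} → φ x ≡ just y → φ x′ ≡ just y → x ≡ x′) →
         x ≡ x′ ⊎ ¬ (∃ λ y → φ x ≡ just y × φ x′ ≡ just y)
  from x x′ inj with x ≟ x′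
  ... | yes x≡x′ = inj₁ x≡x′
  ... | no  x≢x′ = inj₂ λ { (_ , φx≡y , φx′≡y) → x≢x′ (inj φx≡y φx′≡y) }

isInjectivePartial-nothing : ∀ {m n} (v : Pairing m n) → isInjectivePartial (nothing VF.∷ v) ≡ isInjectivePartial v
isInjectivePartial-nothing v =
  det (reflects-map to from (isInjectivePartial-reflects (nothing VF.∷ v))) (isInjectivePartial-reflects v)
  where
  to : InjectivePartial (nothing VF.∷ v) → InjectivePartial v
  to inj x x′ φx≡y φx′≡y = Fin-suc-injective (inj (suc x) (suc x′) φx≡y φx′≡y)
  from : InjectivePartial v → InjectivePartial (nothing VF.∷ v)
  from inj (suc x) (suc x′) φx≡y φx′≡y = cong suc (inj x x′ φx≡y φx′≡y)

isInjectivePartial-just : ∀ {m n} (v : Pairing m n) y →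
  isInjectivePartial (just y VF.∷ v) ≡ isInjectivePartial v ∧ unpairedᵇ v y
isInjectivePartial-just v y =
  det (reflects-map to from (isInjectivePartial-reflects (just y VF.∷ v)))
      (isInjectivePartial-reflects v ×-reflects unpaired-reflects v y)
  where
  to : InjectivePartial (just y VF.∷ v) → InjectivePartial v × Unpaired v y
  to inj = (λ x x′ φx≡y φx′≡y → Fin-suc-injective (inj (suc x) (suc x′) φx≡y φx′≡y))
         , λ x vx≡y → contradiction (inj zero (suc x) refl vx≡y) λ ()
  from : InjectivePartial v × Unpaired v y → InjectivePartial (just y VF.∷ v)
  from (inj , y-free) zero     zero     _    _     = refl
  from (inj , y-free) zero     (suc x′) refl vx′≡y = contradiction vx′≡y (y-free x′)
  from (inj , y-free) (suc x)  zero     vx≡y refl  = contradiction vx≡y (y-free x)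
  from (inj , y-free) (suc x)  (suc x′) vx≡y vx′≡y = cong suc (inj x x′ vx≡y vx′≡y)

∑-partialPairings-suc : ∀ m n (F : Pairing (suc m) n → ℤ) →
  ∑ F (partialPairings (suc m) n)
    ≡ ∑ (λ v → F (nothing VF.∷ v) + ∑ (λ y → if unpairedᵇ v y then F (just y VF.∷ v) else 0ℤ) (allFin n))
        (partialPairings m n)
∑-partialPairings-suc m n F =
  trans (∑-filterᵇ F isInjectivePartial (allMaps (suc m) n))
    (trans (∑-concatMap _ extensions (allMaps m n))
      (trans (∑-cong perPairing (allMaps m n)) (sym (∑-filterᵇ _ isInjectivePartial (allMaps m n)))))
  where
  extensions : Pairing m n → List (Pairing (suc m) n)
  extensions v = map (VF._∷ v) (nothing ∷ map just (allFin n))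
  F̂ : Pairing (suc m) n → ℤ
  F̂ φ = if isInjectivePartial φ then F φ else 0ℤ
  perPairing : ∀ v → ∑ F̂ (extensions v)
    ≡ (if isInjectivePartial v
       then F (nothing VF.∷ v) + ∑ (λ y → if unpairedᵇ v y then F (just y VF.∷ v) else 0ℤ) (allFin n) else 0ℤ)
  perPairing v
    rewrite ∑-map F̂ (VF._∷ v) (map just (allFin n)) | ∑-map (F̂ ∘ (VF._∷ v)) just (allFin n)
          | isInjectivePartial-nothing v
    with isInjectivePartial v in inj
  ... | true  = cong (_+_ (F (nothing VF.∷ v)))
                     (∑-cong (λ y → cong (λ b → if b then F (just y VF.∷ v) else 0ℤ)
                                         (trans (isInjectivePartial-just v y) (cong (_∧ unpairedᵇ v y) inj)))
                             (allFin n))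
  ... | false = trans (+-identityˡ _)
                      (∑-zero (λ y → cong (λ b → if b then F (just y VF.∷ v) else 0ℤ)
                                          (trans (isInjectivePartial-just v y) (cong (_∧ unpairedᵇ v y) inj)))
                              (allFin n))

module _ {m n} (φ : Pairing m n) where

  glued-↑ˡ : ∀ x → glued φ (x ↑ˡ n) ≡ true
  glued-↑ˡ x rewrite splitAt-↑ˡ m x n = refl

  glued-↑ʳ : ∀ y → glued φ (m ↑ʳ y) ≡ unpairedᵇ φ y
  glued-↑ʳ y rewrite splitAt-↑ʳ m n y = refl

  q-↑ˡ : ∀ x → q φ (x ↑ˡ n) ≡ x ↑ˡ n
  q-↑ˡ x rewrite splitAt-↑ˡ m x n = refl

  q-↑ʳ : ∀ y → q φ (m ↑ʳ y) ≡ maybe (_↑ˡ n) (m ↑ʳ y) (preimage φ y)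
  q-↑ʳ y rewrite splitAt-↑ʳ m n y = refl

  q-retraction : IsRetractionOnto (glued φ) (q φ)
  q-retraction = into , fixes
    where
    into : ∀ i → glued φ (q φ i) ≡ true
    into i with sumView m n i
    ... | left x = trans (cong (glued φ) (q-↑ˡ x)) (glued-↑ˡ x)
    ... | right y rewrite q-↑ʳ y with preimage φ y | preimageView φ y
    ...   | just x  | _            = glued-↑ˡ x
    ...   | nothing | unpaired y-free = trans (glued-↑ʳ y) (reflects-true⁺ (unpaired-reflects φ y) y-free)
    fixes : ∀ i → glued φ i ≡ true → q φ i ≡ i
    fixes i gi with sumView m n i
    ... | left x  = q-↑ˡ x
    ... | right y = trans (q-↑ʳ y)
      (cong (maybe (_↑ˡ n) (m ↑ʳ y))
            (preimage-Unpaired φ (reflects-true⁻ (unpaired-reflects φ y) (trans (sym (glued-↑ʳ y)) gi))))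

gluedCoeff : ∀ {m n} → Labelling (m ℕ.+ n) → Pairing m n → ℤ
gluedCoeff π φ = if does (compatible? (q φ) π) then weight (glued φ) π else 0ℤ

coeff-gluedSum : ∀ m n π → coeff (gluedSum m n) π ≡ ∑ (gluedCoeff π) (partialPairings m n)
coeff-gluedSum m n π =
  trans (∑-concatMap _ _ (partialPairings m n)) (∑-cong (λ φ → coeff-pullback-χ (q-retraction φ) π) (partialPairings m n))

-- Removing the first element of X

unpairedᵇ-∷ : ∀ {m n} (a : Maybe (Fin n)) (v : Pairing m n) y → unpairedᵇ (a VF.∷ v) y ≡ not (hits a y) ∧ unpairedᵇ v y
unpairedᵇ-∷ a v y with hits a y
... | true  = refl
... | false with preimage v y
...   | just _  = refl
...   | nothing = refl

q-∷-↑ˡ : ∀ {m n} (a : Maybe (Fin n)) (v : Pairing m n) x → q (a VF.∷ v) (suc (x ↑ˡ n)) ≡ suc (q v (x ↑ˡ n))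
q-∷-↑ˡ a v x = trans (q-↑ˡ (a VF.∷ v) (suc x)) (cong suc (sym (q-↑ˡ v x)))

q-∷-↑ʳ : ∀ {m n} (a : Maybe (Fin n)) (v : Pairing m n) y →
  q (a VF.∷ v) (suc (m ↑ʳ y)) ≡ (if hits a y then zero else suc (q v (m ↑ʳ y)))
q-∷-↑ʳ {m} {n} a v y rewrite q-↑ʳ (a VF.∷ v) y | q-↑ʳ v y with hits a y
... | true  = refl
... | false with preimage v y
...   | just _  = refl
...   | nothing = refl

othersInX : ∀ {m n} → Labelling (suc m ℕ.+ n) → ℕ
othersInX {m} {n} π = count λ x → π (suc (x ↑ˡ n)) ≡ᵇ π zero

membersInY : ∀ {m n} → Labelling (suc m ℕ.+ n) → ℕ
membersInY {m} {n} π = count λ y → π (suc (m ↑ʳ y)) ≡ᵇ π zero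

-- The factor by which the first element of X multiplies both sides when its part contains
-- kx further elements of X and ty elements of Y.
headFactor : ℕ → ℕ → ℤ
headFactor zero    zero    = 1ℤ
headFactor zero    (suc _) = 0ℤ
headFactor (suc k) _       = laterFactor (suc k)

laterFactor-+ : ∀ kx p ty → (kx ≡ 0 → p ≡ ty) → laterFactor (kx ℕ.+ p) + + p ≡ headFactor kx ty
laterFactor-+ zero    p ty p≡ty with p≡ty refl
laterFactor-+ zero    zero    zero    _ | refl = refl
laterFactor-+ zero    (suc t) (suc t) _ | refl = ℤ.+-inverseˡ (+ suc t)
laterFactor-+ (suc k) p       ty      _ =
  solve 2 (λ a b → (:- (a :+ b)) :+ b := :- a) refl (+ suc k) (+ p)
  where open +-*-Solver

module Extension {m n} (v : Pairing m n) (π : Labelling (suc m ℕ.+ n)) where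

  π′ : Labelling (m ℕ.+ n)
  π′ = π ∘ suc

  q-nothing : ∀ i → q (nothing VF.∷ v) (suc i) ≡ suc (q v i)
  q-nothing i with sumView m n i
  ... | left x  = q-∷-↑ˡ nothing v x
  ... | right y = q-∷-↑ʳ nothing v y

  glued-nothing : ∀ i → glued (nothing VF.∷ v) (suc i) ≡ glued v i
  glued-nothing i with sumView m n i
  ... | left x  = trans (glued-↑ˡ (nothing VF.∷ v) (suc x)) (sym (glued-↑ˡ v x))
  ... | right y = trans (glued-↑ʳ (nothing VF.∷ v) y) (trans (unpairedᵇ-∷ nothing v y) (sym (glued-↑ʳ v y)))

  compatible-nothing : Compatible (q (nothing VF.∷ v)) π ⇔ Compatible (q v) π′
  compatible-nothing = mk⇔ (λ c i → trans (cong π (sym (q-nothing i))) (c (suc i)))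
                           (λ { c zero → refl ; c (suc i) → trans (cong π (q-nothing i)) (c i) })

  weight-nothing :
    weight (glued (nothing VF.∷ v)) π ≡ laterFactor (count (inPart (glued v) π′ (π zero))) * weight (glued v) π′
  weight-nothing = cong₂ (λ k w → laterFactor k * w)
    (count-cong λ j → cong (_∧ (π′ j ≡ᵇ π zero)) (glued-nothing j)) (weight-cong-subset π′ glued-nothing)

  module _ {y₀} (y₀-free : Unpaired v y₀) where

    y₀-glued : glued v (m ↑ʳ y₀) ≡ true
    y₀-glued = trans (glued-↑ʳ v y₀) (reflects-true⁺ (unpaired-reflects v y₀) y₀-free)

    y≢y₀ : ∀ {y} → m ↑ʳ y ≢ m ↑ʳ y₀ → hits (just y₀) y ≡ false
    y≢y₀ {y} ne = reflects-false⁺ (hits-reflects (just y₀) y) (ne ∘ cong (m ↑ʳ_) ∘ sym ∘ just-injective)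

    glued-just : Without (glued v) (m ↑ʳ y₀) (glued (just y₀ VF.∷ v) ∘ suc)
    glued-just = removed , kept
      where
      removed : glued (just y₀ VF.∷ v) (suc (m ↑ʳ y₀)) ≡ false
      removed = trans (glued-↑ʳ (just y₀ VF.∷ v) y₀)
                      (trans (unpairedᵇ-∷ (just y₀) v y₀) (cong (λ b → not b ∧ unpairedᵇ v y₀) (hits-self y₀)))
      kept : ∀ j → j ≢ m ↑ʳ y₀ → glued (just y₀ VF.∷ v) (suc j) ≡ glued v j
      kept j j≢y₀ with sumView m n j
      ... | left x  = trans (glued-↑ˡ (just y₀ VF.∷ v) (suc x)) (sym (glued-↑ˡ v x))
      ... | right y = trans (glued-↑ʳ (just y₀ VF.∷ v) y)
                        (trans (unpairedᵇ-∷ (just y₀) v y)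
                          (trans (cong (λ b → not b ∧ unpairedᵇ v y) (y≢y₀ j≢y₀)) (sym (glued-↑ʳ v y))))

    q-just-y₀ : q (just y₀ VF.∷ v) (suc (m ↑ʳ y₀)) ≡ zero
    q-just-y₀ = trans (q-∷-↑ʳ (just y₀) v y₀) (cong (λ b → if b then zero else suc (q v (m ↑ʳ y₀))) (hits-self y₀))

    q-just : ∀ j → j ≢ m ↑ʳ y₀ → q (just y₀ VF.∷ v) (suc j) ≡ suc (q v j)
    q-just j j≢y₀ with sumView m n j
    ... | left x  = q-∷-↑ˡ (just y₀) v x
    ... | right y = trans (q-∷-↑ʳ (just y₀) v y) (cong (λ b → if b then zero else suc (q v (m ↑ʳ y))) (y≢y₀ j≢y₀))

    compatible-just : Compatible (q (just y₀ VF.∷ v)) π ⇔ (Compatible (q v) π′ × π′ (m ↑ʳ y₀) ≡ π zero)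
    compatible-just = mk⇔ to from
      where
      to : Compatible (q (just y₀ VF.∷ v)) π → Compatible (q v) π′ × π′ (m ↑ʳ y₀) ≡ π zero
      to c = compatible , sym (trans (cong π (sym q-just-y₀)) (c (suc (m ↑ʳ y₀))))
        where
        compatible : Compatible (q v) π′
        compatible i with i ≟ m ↑ʳ y₀
        ... | yes refl = cong π′ (proj₂ (q-retraction v) _ y₀-glued)
        ... | no i≢y₀  = trans (cong π (sym (q-just i i≢y₀))) (c (suc i))
      from : Compatible (q v) π′ × π′ (m ↑ʳ y₀) ≡ π zero → Compatible (q (just y₀ VF.∷ v)) π
      from (c , y₀~x₀) zero = refl
      from (c , y₀~x₀) (suc i) with i ≟ m ↑ʳ y₀
      ... | yes refl = trans (cong π q-just-y₀) (sym y₀~x₀)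
      ... | no i≢y₀  = trans (cong π (q-just i i≢y₀)) (c i)

    weight-just : π′ (m ↑ʳ y₀) ≡ π zero → weight (glued (just y₀ VF.∷ v)) π ≡ weight (glued v) π′
    weight-just y₀~x₀ = sym (trans (weight-Without π′ y₀-glued glued-just)
      (cong (λ a → laterFactor (count (inPart (glued (just y₀ VF.∷ v) ∘ suc) π′ a))
                   * weight (glued (just y₀ VF.∷ v) ∘ suc) π′)
            y₀~x₀))

    gluedCoeff-just : gluedCoeff π (just y₀ VF.∷ v)
      ≡ (if does (compatible? (q v) π′)
         then (if π′ (m ↑ʳ y₀) ≡ᵇ π zero then weight (glued v) π′ else 0ℤ) else 0ℤ)
    gluedCoeff-just =
      trans (cong (λ b → if b then weight (glued (just y₀ VF.∷ v)) π else 0ℤ)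
                  (does-⇔ compatible-just (compatible? _ π)
                          (compatible? (q v) π′ ×-dec (π′ (m ↑ʳ y₀) ℕₚ.≟ π zero))))
            (decide (compatible? (q v) π′) (π′ (m ↑ʳ y₀) ℕₚ.≟ π zero))
      where
      decide : (c? : Dec (Compatible (q v) π′)) (e? : Dec (π′ (m ↑ʳ y₀) ≡ π zero)) →
        (if does c? ∧ does e? then weight (glued (just y₀ VF.∷ v)) π else 0ℤ)
          ≡ (if does c? then (if does e? then weight (glued v) π′ else 0ℤ) else 0ℤ)
      decide (yes _) (yes y₀~x₀) = weight-just y₀~x₀
      decide (yes _) (no _)      = refl
      decide (no _)  _           = refl

  gluedCoeff-nothing : gluedCoeff π (nothing VF.∷ v)
    ≡ (if does (compatible? (q v) π′) then laterFactor (count (inPart (glued v) π′ (π zero))) * weight (glued v) π′ else 0ℤ)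
  gluedCoeff-nothing =
    cong₂ (λ b w → if b then w else 0ℤ) (does-⇔ compatible-nothing (compatible? _ π) (compatible? (q v) π′)) weight-nothing

  Kˣ : ℕ
  Kˣ = othersInX {m} {n} π

  Tʸ : ℕ
  Tʸ = membersInY {m} {n} π

  freeInPart : Fin n → Bool
  freeInPart y = unpairedᵇ v y ∧ (π′ (m ↑ʳ y) ≡ᵇ π zero)

  count-glued : count (inPart (glued v) π′ (π zero)) ≡ Kˣ ℕ.+ count freeInPart
  count-glued = trans (count-↑ m n _)
    (cong₂ ℕ._+_ (count-cong λ x → cong (_∧ (π′ (x ↑ˡ n) ≡ᵇ π zero)) (glued-↑ˡ v x))
                 (count-cong λ y → cong (_∧ (π′ (m ↑ʳ y) ≡ᵇ π zero)) (glued-↑ʳ v y)))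

  -- By compatibility, the partner in X of a paired y lies in the part of y.
  unpaired-in-part : Compatible (q v) π′ → Kˣ ≡ 0 → ∀ y → π′ (m ↑ʳ y) ≡ π zero → preimage v y ≡ nothing
  unpaired-in-part c Kˣ≡0 y y~x₀ with preimage v y in eq
  ... | nothing = refl
  ... | just x  = contradiction x~x₀ (count-≡ᵇ≡0⇒ (π′ ∘ (_↑ˡ n)) Kˣ≡0 x)
    where
    x~x₀ : π′ (x ↑ˡ n) ≡ π zero
    x~x₀ = trans (cong π′ (sym (trans (q-↑ʳ v y) (cong (maybe (_↑ˡ n) (m ↑ʳ y)) eq)))) (trans (c (m ↑ʳ y)) y~x₀)

  count-freeInPart : Compatible (q v) π′ → Kˣ ≡ 0 → count freeInPart ≡ Tʸ
  count-freeInPart c Kˣ≡0 = count-cong free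
    where
    free : ∀ y → freeInPart y ≡ (π′ (m ↑ʳ y) ≡ᵇ π zero)
    free y with π′ (m ↑ʳ y) ≡ᵇ π zero | ≡ᵇ-reflects (π′ (m ↑ʳ y)) (π zero)
    ... | false | _         = ∧-zeroʳ (unpairedᵇ v y)
    ... | true  | ofʸ y~x₀ = trans (∧-identityʳ _) (cong (not ∘ is-just) (unpaired-in-part c Kˣ≡0 y y~x₀))

  extension-sum :
    gluedCoeff π (nothing VF.∷ v) + ∑ (λ y → if unpairedᵇ v y then gluedCoeff π (just y VF.∷ v) else 0ℤ) (allFin n)
      ≡ headFactor Kˣ Tʸ * gluedCoeff π′ v
  extension-sum = trans (cong₂ _+_ gluedCoeff-nothing (∑-cong each (allFin n))) (decide (compatible? (q v) π′))
    where
    W : ℤ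
    W = weight (glued v) π′
    K : ℕ
    K = count (inPart (glued v) π′ (π zero))
    term : Bool → Fin n → ℤ
    term c y = if unpairedᵇ v y then (if c then (if π′ (m ↑ʳ y) ≡ᵇ π zero then W else 0ℤ) else 0ℤ) else 0ℤ
    each : ∀ y → (if unpairedᵇ v y then gluedCoeff π (just y VF.∷ v) else 0ℤ) ≡ term (does (compatible? (q v) π′)) y
    each y with unpairedᵇ v y | unpaired-reflects v y
    ... | true  | ofʸ y-free = gluedCoeff-just y-free
    ... | false | _          = refl
    nest : ∀ y → term true y ≡ (if freeInPart y then W else 0ℤ)
    nest y with unpairedᵇ v y
    ... | true  = refl
    ... | false = refl
    decide : (c? : Dec (Compatible (q v) π′)) →
      (if does c? then laterFactor K * W else 0ℤ) + ∑ (term (does c?)) (allFin n)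
        ≡ headFactor Kˣ Tʸ * (if does c? then W else 0ℤ)
    decide (no _) =
      trans (+-identityˡ _) (trans (∑-zero (λ y → zero-either (unpairedᵇ v y)) (allFin n)) (sym (*-zeroʳ (headFactor Kˣ Tʸ))))
      where
      zero-either : ∀ b → (if b then 0ℤ else 0ℤ) ≡ 0ℤ
      zero-either true  = refl
      zero-either false = refl
    decide (yes c) = begin
      laterFactor K * W + ∑ (term true) (allFin n)
        ≡⟨ cong (_+_ (laterFactor K * W)) (trans (∑-cong nest (allFin n)) (∑-tabulate-indicator freeInPart W id)) ⟩
      laterFactor K * W + + count freeInPart * W
        ≡⟨ sym (ℤ.*-distribʳ-+ W (laterFactor K) (+ count freeInPart)) ⟩
      (laterFactor K + + count freeInPart) * W
        ≡⟨ cong (λ k → (laterFactor k + + count freeInPart) * W) count-glued ⟩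
      (laterFactor (Kˣ ℕ.+ count freeInPart) + + count freeInPart) * W
        ≡⟨ cong (_* W) (laterFactor-+ Kˣ (count freeInPart) Tʸ (count-freeInPart c)) ⟩
      headFactor Kˣ Tʸ * W ∎
      where open ≡-Reasoning

∑-gluedCoeff-suc : ∀ m n (π : Labelling (suc m ℕ.+ n)) →
  ∑ (gluedCoeff π) (partialPairings (suc m) n)
    ≡ headFactor (othersInX {m} {n} π) (membersInY {m} {n} π) * ∑ (gluedCoeff (π ∘ suc)) (partialPairings m n)
∑-gluedCoeff-suc m n π =
  trans (∑-partialPairings-suc m n (gluedCoeff π))
        (trans (∑-cong (λ v → Extension.extension-sum v π) (partialPairings m n))
               (∑-*ˡ (headFactor (othersInX {m} {n} π) (membersInY {m} {n} π)) (gluedCoeff (π ∘ suc)) (partialPairings m n)))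

headFactor-zero : ∀ k → headFactor k 0 ≡ laterFactor k
headFactor-zero zero    = refl
headFactor-zero (suc k) = refl

productCoeff-meetsY : ∀ m n (π : Labelling (suc m ℕ.+ n)) {t} → membersInY {m} {n} π ≡ suc t →
  productCoeff (suc m) n π ≡ 0ℤ
productCoeff-meetsY m n π #Y with count-≡ᵇ≡suc⇒ (π ∘ suc ∘ (m ↑ʳ_)) #Y
... | y , y~x₀ =
  cong (λ b → if b then weight full (π ∘ (_↑ˡ n)) * weight full (π ∘ (suc m ↑ʳ_)) else 0ℤ)
       (dec-false (separated? π) λ s → s zero y (sym y~x₀))

productCoeff-missesY : ∀ m n (π : Labelling (suc m ℕ.+ n)) → membersInY {m} {n} π ≡ 0 →
  productCoeff (suc m) n π ≡ laterFactor (othersInX {m} {n} π) * productCoeff m n (π ∘ suc)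
productCoeff-missesY m n π #Y = begin
  (if does (separated? {suc m} {n} π) then k * A * B else 0ℤ)
    ≡⟨ cong (λ b → if b then k * A * B else 0ℤ)
            (does-⇔ (mk⇔ (proj₂ ∘ Equivalence.to (separated-suc π)) (λ s′ → Equivalence.from (separated-suc π) (no-Y , s′)))
                    (separated? π) (separated? (π ∘ suc))) ⟩
  (if does (separated? {m} {n} (π ∘ suc)) then k * A * B else 0ℤ)
    ≡⟨ distribute (does (separated? {m} {n} (π ∘ suc))) ⟩
  k * (if does (separated? {m} {n} (π ∘ suc)) then A * B else 0ℤ) ∎
  where
  open ≡-Reasoning
  k : ℤ
  k = laterFactor (othersInX {m} {n} π)
  A : ℤ
  A = weight full (π ∘ suc ∘ (_↑ˡ n))
  B : ℤ
  B = weight full (π ∘ suc ∘ (m ↑ʳ_))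
  no-Y : ∀ y → π zero ≢ π (suc (m ↑ʳ y))
  no-Y y = count-≡ᵇ≡0⇒ (π ∘ suc ∘ (m ↑ʳ_)) #Y y ∘ sym
  distribute : ∀ b → (if b then k * A * B else 0ℤ) ≡ k * (if b then A * B else 0ℤ)
  distribute true  = *-assoc k A B
  distribute false = sym (*-zeroʳ k)

productCoeff-suc : ∀ m n (π : Labelling (suc m ℕ.+ n)) →
  headFactor (othersInX {m} {n} π) (membersInY {m} {n} π) * productCoeff m n (π ∘ suc) ≡ productCoeff (suc m) n π
productCoeff-suc m n π = step (othersInX {m} {n} π) (membersInY {m} {n} π) refl refl
  where
  step : ∀ kx ty → othersInX {m} {n} π ≡ kx → membersInY {m} {n} π ≡ ty →
    headFactor kx ty * productCoeff m n (π ∘ suc) ≡ productCoeff (suc m) n π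
  step kx zero #X #Y =
    trans (cong (_* productCoeff m n (π ∘ suc)) (trans (headFactor-zero kx) (cong laterFactor (sym #X))))
          (sym (productCoeff-missesY m n π #Y))
  step zero    (suc t) #X #Y = trans (ℤ.*-zeroˡ (productCoeff m n (π ∘ suc))) (sym (productCoeff-meetsY m n π #Y))
  step (suc k) (suc t) #X #Y with count-≡ᵇ≡suc⇒ (π ∘ suc ∘ (_↑ˡ n)) #X | count-≡ᵇ≡suc⇒ (π ∘ suc ∘ (m ↑ʳ_)) #Y
  ... | x , x~x₀ | y , y~x₀ =
    trans (cong (λ b → laterFactor (suc k) * (if b then A * B else 0ℤ))
                (dec-false (separated? (π ∘ suc)) λ s → s x y (trans x~x₀ (sym y~x₀))))
          (trans (*-zeroʳ (laterFactor (suc k))) (sym (productCoeff-meetsY m n π #Y)))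
    where
    A : ℤ
    A = weight full (π ∘ suc ∘ (_↑ˡ n))
    B : ℤ
    B = weight full (π ∘ suc ∘ (m ↑ʳ_))

-- For m = 0, q is the identity and glued is full by computation.
∑-gluedCoeff≡productCoeff : ∀ m n π → ∑ (gluedCoeff π) (partialPairings m n) ≡ productCoeff m n π
∑-gluedCoeff≡productCoeff zero    n π =
  trans (+-identityʳ _)
        (trans (cong (λ b → if b then weight full π else 0ℤ) (dec-true (compatible? (q {0} {n} VF.[]) π) λ _ → refl))
               (sym (*-identityˡ _)))
∑-gluedCoeff≡productCoeff (suc m) n π =
  trans (∑-gluedCoeff-suc m n π)
        (trans (cong (headFactor (othersInX {m} {n} π) (membersInY {m} {n} π) *_) (∑-gluedCoeff≡productCoeff m n (π ∘ suc)))
               (productCoeff-suc m n π))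

proposition1p2 : (m n : ℕ) → gluedSum m n ≋ (χ {m} full ⊛ χ {n} full)
proposition1p2 m n π = begin
  coeff (gluedSum m n) π                  ≡⟨ coeff-gluedSum m n π ⟩
  ∑ (gluedCoeff π) (partialPairings m n)  ≡⟨ ∑-gluedCoeff≡productCoeff m n π ⟩
  productCoeff m n π                      ≡⟨ sym (coeff-χ⊛χ m n π) ⟩
  coeff (χ {m} full ⊛ χ {n} full) π       ∎
  where open ≡-Reasoning
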